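{- Let $\mathbf s:\mathcal H\to\mathcal H$ be the unique algebra anti-automorphism with $\mathbf s(Y_u^i)=Y_{u^*}^i$ for all generators, where $u^*=u(p)\cdots u(1)$ is the reversal of $u=u(1)\cdots u(p)$. Then $m^{op}=\mathbf s\circ m\circ(\mathbf s\otimes\mathbf s)$, $\Delta=(\mathbf s\otimes\mathbf s)\circ\Delta\circ\mathbf s$, and $S_{\mathcal L}=\mathbf s\circ S_{\mathcal H}\circ\mathbf s$.
   Context: Fix $N\ge1$, let $\langle N\rangle=\{1,\ldots,N\}$ and $\langle N\rangle^*$ the free monoid of words over $\langle N\rangle$; for $u=u(1)\cdots u(p)$ write $|u|=p$ and for an interval $C\subseteq\{1,\ldots,p\}$ let $u|C$ be the subword $(u(k))_{k\in C}$. Let $\mathcal H=\mathcal H^N$ be the free unital associative algebra over $\mathbb C$ on symbols $Y_u^i$ ($i\in\langle N\rangle$, $u\in\langle N\rangle^*$, $|u|\ge2$), with multiplication $m$, and adopt the convention $Y_j^i=\delta_{ij}1$ for $i,j\in\langle N\rangle$. It is a bialgebra with multiplicative counit $\varepsilon(1)=1$, $\varepsilon(Y_u^i)=0$ ($|u|\ge 2$), and algebra-homomorphism coproduct given for $|u|=p$ by $$\Delta(Y_u^i)=\sum_{q=1}^{p}\sum_{(C_1,\ldots,C_q)}\sum_{v\in\langle N\rangle^q}Y_{u|C_1}^{v(1)}\cdots Y_{u|C_q}^{v(q)}\otimes Y_v^i,$$ the middle sum over all partitions of $\{1,\ldots,p\}$ into $q$ nonempty consecutive intervals $C_1<\cdots<C_q$.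 (This is the incidence Hopf algebra of $N$-colored interval partitions.) It is graded (by $|u|-1$) and connected, hence a Hopf algebra with antipode $S_{\mathcal H}$, which is invertible. $m^{op}=m\circ\tau$ with $\tau$ the flip $a\otimes b\mapsto b\otimes a$. The left Lagrange Hopf algebra is $\mathcal L=(\mathcal H,m,1,\Delta^{op}=\tau\circ\Delta,\varepsilon,S_{\mathcal L})$ with $S_{\mathcal L}=S_{\mathcal H}^{ -1}$. -}

module Defs where

open import Level using (_⊔_)
open import Algebra.Bundles using (CommutativeRing)
open import Data.Nat using (ℕ; zero; suc)
open import Data.Fin using (Fin)
import Data.Fin.Properties as FinP
open import Data.List using (List; []; _∷_; _++_; map; concatMap; foldr; reverse; allFin; length; zipWith)
import Data.List.Properties as ListP
open import Data.Product using (_×_; _,_)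
import Data.Product.Properties as ProdP
open import Relation.Nullary using (Dec; yes; no)
open import Relation.Binary.PropositionalEquality using (_≡_)

-- Incidence Hopf algebra H^N of N-colored interval partitions, with
-- coefficients in an arbitrary commutative ring R (C is not available).
module HopfDefs {c ℓ} (R : CommutativeRing c ℓ) (N : ℕ) where
  open CommutativeRing R renaming (Carrier to K)

  Letter : Set
  Letter = Fin N

  Word : Set
  Word = List Letter

  -- generator Y^i_u with u = a ∷ b ∷ r (so |u| ≥ 2), encoded as (i , a , b , r)
  Gen : Set
  Gen = Letter × Letter × Letter × Word

  Mon : Set
  Mon = List Gen

  _≟Gen_ : (g h : Gen) → Dec (g ≡ h)
  _≟Gen_ = ProdP.≡-dec FinP._≟_ (ProdP.≡-dec FinP._≟_ (ProdP.≡-dec FinP._≟_ (ListP.≡-dec FinP._≟_)))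

  _≟Mon_ : (v w : Mon) → Dec (v ≡ w)
  _≟Mon_ = ListP.≡-dec _≟Gen_

  -- elements of H: finite formal R-linear combinations of monomials
  H : Set c
  H = List (K × Mon)

  H⊗H : Set c
  H⊗H = List (K × Mon × Mon)

  sumK : List K → K
  sumK = foldr _+_ 0#

  coeff : H → Mon → K
  coeff x w = sumK (map (λ { (a , m) → sel a m }) x)
    where
    sel : K → Mon → K
    sel a m with m ≟Mon w
    ... | yes _ = a
    ... | no  _ = 0#

  coeff₂ : H⊗H → Mon → Mon → K
  coeff₂ t w₁ w₂ = sumK (map (λ { (a , m , n) → sel a m n }) t)
    where
    sel : K → Mon → Mon → K
    sel a m n with m ≟Mon w₁ | n ≟Mon w₂
    ... | yes _ | yes _ = a
    ... | _     | _     = 0#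

  infix 4 _≈H_ _≈T_
  _≈H_ : H → H → Set ℓ
  x ≈H y = ∀ w → coeff x w ≈ coeff y w

  _≈T_ : H⊗H → H⊗H → Set ℓ
  s ≈T t = ∀ w₁ w₂ → coeff₂ s w₁ w₂ ≈ coeff₂ t w₁ w₂

  zeroH : H
  zeroH = []

  oneH : H
  oneH = (1# , []) ∷ []

  scale : K → H → H
  scale a = map (λ { (b , m) → (a * b , m) })

  scale₂ : K → H⊗H → H⊗H
  scale₂ a = map (λ { (b , m , n) → (a * b , m , n) })

  _·_ : H → H → H
  x · y = concatMap (λ { (a , m) → map (λ { (b , n) → (a * b , m ++ n) }) y }) x

  prodH : List H → H
  prodH = foldr _·_ oneH

  _⊗_ : H → H → H⊗H
  x ⊗ y = concatMap (λ { (a , m) → map (λ { (b , n) → (a * b , m , n) }) y }) x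

  _·T_ : H⊗H → H⊗H → H⊗H
  s ·T t = concatMap (λ { (a , m , m') → map (λ { (b , n , n') → (a * b , m ++ n , m' ++ n') }) t }) s

  oneT : H⊗H
  oneT = (1# , [] , []) ∷ []

  ext : (Mon → H) → H → H
  ext f = concatMap (λ { (a , m) → scale a (f m) })

  ext→T : (Mon → H⊗H) → H → H⊗H
  ext→T f = concatMap (λ { (a , m) → scale₂ a (f m) })

  extT→ : (Mon → Mon → H) → H⊗H → H
  extT→ f = concatMap (λ { (a , m , n) → scale a (f m n) })

  extT→T : (Mon → Mon → H⊗H) → H⊗H → H⊗H
  extT→T f = concatMap (λ { (a , m , n) → scale₂ a (f m n) })

  basis : Mon → H
  basis m = (1# , m) ∷ []

  -- Y^i_w for an arbitrary nonempty word w, with the convention Y^i_j = δ_ij 1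
  Y : Letter → Word → H
  Y i []            = zeroH   -- never used (blocks and v are nonempty)
  Y i (j ∷ [])      with i FinP.≟ j
  ... | yes _ = oneH
  ... | no  _ = zeroH
  Y i (a ∷ b ∷ r)   = basis ((i , a , b , r) ∷ [])

  -- all partitions of a word into nonempty consecutive blocks
  -- (equivalently: interval partitions C₁ < ⋯ < C_q of {1,…,p})
  splits : Word → List (List Word)
  splits [] = [] ∷ []
  splits (x ∷ xs) = concatMap ext1 (splits xs)
    where
    ext1 : List Word → List (List Word)
    ext1 []        = ((x ∷ []) ∷ []) ∷ []
    ext1 (B ∷ Bs)  = ((x ∷ []) ∷ B ∷ Bs) ∷ ((x ∷ B) ∷ Bs) ∷ []

  wordsOfLength : ℕ → List Word
  wordsOfLength zero    = [] ∷ []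
  wordsOfLength (suc q) = concatMap (λ j → map (j ∷_) (wordsOfLength q)) (allFin N)

  mH : H⊗H → H
  mH = extT→ (λ m n → basis (m ++ n))

  mop : H⊗H → H
  mop = extT→ (λ m n → basis (n ++ m))

  εMon : Mon → K
  εMon []      = 1#
  εMon (_ ∷ _) = 0#

  εH : H → K
  εH x = sumK (map (λ { (a , m) → a * εMon m }) x)

  Δgen : Gen → H⊗H
  Δgen (i , a , b , r) =
    concatMap (λ Bs → concatMap (λ v → prodH (zipWith (λ j B → Y j B) v Bs) ⊗ Y i v)
                                (wordsOfLength (length Bs)))
              (splits (a ∷ b ∷ r))

  ΔMon : Mon → H⊗H
  ΔMon m = foldr _·T_ oneT (map Δgen m)

  ΔH : H → H⊗H
  ΔH = ext→T ΔMon

  sGen : Gen → H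
  sGen (i , a , b , r) = Y i (reverse (a ∷ b ∷ r))

  sMon : Mon → H
  sMon m = prodH (reverse (map sGen m))

  sH : H → H
  sH = ext sMon

  s⊗s : H⊗H → H⊗H
  s⊗s = extT→T (λ m n → sMon m ⊗ sMon n)

  IsAntipode : (Mon → H) → Set (c ⊔ ℓ)
  IsAntipode S =
    (∀ x → mH (extT→T (λ m n → S m ⊗ basis n) (ΔH x)) ≈H scale (εH x) oneH) ×
    (∀ x → mH (extT→T (λ m n → basis m ⊗ S n) (ΔH x)) ≈H scale (εH x) oneH)

-- Everything is proved in weak form: a formal combination x = Σ aᵢ mᵢ is identified with the
-- functional g ↦ ⟪ x ∣ g ⟫ = Σ aᵢ g(mᵢ) on weights g, which is equivalent to coefficientwise
-- equality because the monomials form a basis.  On monomials s is the reversal m ↦ m*, an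
-- involutive anti-automorphism of the free monoid, which gives the statement for m^op.  Reversing
-- u reverses every interval partition of u together with the colouring word v, so it permutes the
-- terms of Δ(Y^i_u); this gives Δ ∘ s = (s ⊗ s) ∘ Δ.  For the antipode, S_H is anti-multiplicative
-- and, applying s to the antipode identity, T = s S_H s satisfies Σ u₂ T(u₁) = ε(u).  Comparing
-- this with Σ u₁ S_H(u₂) = ε(u) term by term, induction on the degree gives S_H ∘ T = id, and
-- conjugating by s gives T ∘ S_H = id.

module Submission where

open import Defs
open import Algebra.Bundles using (CommutativeRing)
open import Level using (_⊔_)
open import Data.Nat using (ℕ; zero; suc; _≤_; _<_; s≤s; z≤n)
open import Data.Product using (_×_; _,_; proj₁; proj₂)
open import Data.List using (List; []; _∷_; _++_; _∷ʳ_; map; concat; concatMap; deduplicate; reverse; length; zipWith; allFin)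
import Data.List.Properties as List
import Data.Nat.Properties as ℕ
import Data.Fin.Properties as Fin
open import Data.List.Relation.Unary.All as All using (All; []; _∷_)
import Data.List.Relation.Unary.All.Properties as All
open import Data.List.Relation.Unary.Any using (here; there)
open import Data.List.Membership.Propositional using (_∈_)
open import Data.List.Membership.Propositional.Properties using (∈-deduplicate⁺; ∈-++⁺ˡ; ∈-++⁺ʳ; ∈-map⁺; ∈-allFin)
import Data.List.Relation.Unary.Unique.DecPropositional.Properties as Unique
open import Data.List.Relation.Unary.Unique.Propositional using (Unique)
open import Data.List.Relation.Unary.AllPairs using (_∷_)
open import Relation.Binary.Definitions using (DecidableEquality)
open import Relation.Binary.PropositionalEquality as ≡ using (_≡_)
open import Relation.Nullary using (¬_; yes; no; contradiction)

All-concatMap : ∀ {a b p} {A : Set a} {B : Set b} {P : B → Set p} {f : A → List B} {l} →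
                All (λ x → All P (f x)) l → All P (concatMap f l)
All-concatMap ps = All.concat⁺ (All.map⁺ ps)

module Linear {c ℓ} (R : CommutativeRing c ℓ) where
  open CommutativeRing R renaming (Carrier to K)
  open import Algebra.Properties.CommutativeSemigroup +-commutativeSemigroup using (interchange)
  open import Algebra.Properties.CommutativeSemigroup *-commutativeSemigroup using (x∙yz≈y∙xz)
  open import Relation.Binary.Reasoning.Setoid setoid

  ∑ : ∀ {a} {A : Set a} → List A → (A → K) → K
  ∑ []      f = 0#
  ∑ (a ∷ l) f = f a + ∑ l f

  module _ {a} {A : Set a} where
    ∑-++ : ∀ (l l′ : List A) f → ∑ (l ++ l′) f ≈ ∑ l f + ∑ l′ f
    ∑-++ []      l′ f = sym (+-identityˡ _)
    ∑-++ (a ∷ l) l′ f = trans (+-congˡ (∑-++ l l′ f)) (sym (+-assoc _ _ _))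

    ∑-cong-All : ∀ {P : A → Set} {l} → All P l → {f g : A → K} →
                 (∀ {a} → P a → f a ≈ g a) → ∑ l f ≈ ∑ l g
    ∑-cong-All []       f≈g = refl
    ∑-cong-All (p ∷ ps) f≈g = +-cong (f≈g p) (∑-cong-All ps f≈g)

    ∑-cong : ∀ (l : List A) {f g : A → K} → (∀ a → f a ≈ g a) → ∑ l f ≈ ∑ l g
    ∑-cong []      f≈g = refl
    ∑-cong (a ∷ l) f≈g = +-cong (f≈g a) (∑-cong l f≈g)

    ∑-zero : ∀ (l : List A) {f} → (∀ a → f a ≈ 0#) → ∑ l f ≈ 0#
    ∑-zero []      f≈0 = refl
    ∑-zero (a ∷ l) f≈0 = trans (+-cong (f≈0 a) (∑-zero l f≈0)) (+-identityˡ 0#)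

    ∑-+ : ∀ (l : List A) f g → ∑ l (λ a → f a + g a) ≈ ∑ l f + ∑ l g
    ∑-+ []      f g = sym (+-identityˡ _)
    ∑-+ (a ∷ l) f g = trans (+-congˡ (∑-+ l f g)) (interchange _ _ _ _)

    ∑-* : ∀ (l : List A) k f → ∑ l (λ a → k * f a) ≈ k * ∑ l f
    ∑-* []      k f = sym (zeroʳ k)
    ∑-* (a ∷ l) k f = trans (+-congˡ (∑-* l k f)) (sym (distribˡ k _ _))

    ∑-concatMap : ∀ {b} {B : Set b} (F : B → List A) l f → ∑ (concatMap F l) f ≈ ∑ l (λ b → ∑ (F b) f)
    ∑-concatMap F []      f = refl
    ∑-concatMap F (b ∷ l) f = trans (∑-++ (F b) _ f) (+-congˡ (∑-concatMap F l f))

    ∑-map : ∀ {b} {B : Set b} (F : B → A) l f → ∑ (map F l) f ≡ ∑ l (λ b → f (F b))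
    ∑-map F []      f = ≡.refl
    ∑-map F (b ∷ l) f = ≡.cong (f (F b) +_) (∑-map F l f)

  ∑-swap : ∀ {a b} {A : Set a} {B : Set b} (l : List A) (l′ : List B) (F : A → B → K) →
           ∑ l (λ a → ∑ l′ (F a)) ≈ ∑ l′ (λ b → ∑ l (λ a → F a b))
  ∑-swap []      l′ F = sym (∑-zero l′ (λ _ → refl))
  ∑-swap (a ∷ l) l′ F = trans (+-congˡ (∑-swap l l′ F)) (sym (∑-+ l′ _ _))

  Combination : Set → Set c
  Combination B = List (K × B)

  ⟪_∣_⟫ : {B : Set} → Combination B → (B → K) → K
  ⟪ x ∣ g ⟫ = ∑ x (λ (a , b) → a * g b)

  infix 4 _≋_
  _≋_ : {B : Set} → Combination B → Combination B → Set (c ⊔ ℓ)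
  x ≋ y = ∀ g → ⟪ x ∣ g ⟫ ≈ ⟪ y ∣ g ⟫

  module _ {B : Set} where
    ⟪⟫-cong-All : ∀ {P : B → Set} {x : Combination B} → All (λ e → P (proj₂ e)) x →
                  {g h : B → K} → (∀ {b} → P b → g b ≈ h b) → ⟪ x ∣ g ⟫ ≈ ⟪ x ∣ h ⟫
    ⟪⟫-cong-All ps g≈h = ∑-cong-All ps (λ p → *-congˡ (g≈h p))

    ⟪⟫-cong : ∀ (x : Combination B) {g h} → (∀ b → g b ≈ h b) → ⟪ x ∣ g ⟫ ≈ ⟪ x ∣ h ⟫
    ⟪⟫-cong x g≈h = ∑-cong x (λ (a , b) → *-congˡ (g≈h b))

    ⟪⟫-zero : ∀ (x : Combination B) {g} → (∀ b → g b ≈ 0#) → ⟪ x ∣ g ⟫ ≈ 0#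
    ⟪⟫-zero x g≈0 = ∑-zero x (λ (a , b) → trans (*-congˡ (g≈0 b)) (zeroʳ a))

    ⟪⟫-+ : ∀ (x : Combination B) g h → ⟪ x ∣ (λ b → g b + h b) ⟫ ≈ ⟪ x ∣ g ⟫ + ⟪ x ∣ h ⟫
    ⟪⟫-+ x g h = trans (∑-cong x (λ (a , b) → distribˡ a (g b) (h b))) (∑-+ x _ _)

    ⟪⟫-* : ∀ (x : Combination B) k g → ⟪ x ∣ (λ b → k * g b) ⟫ ≈ k * ⟪ x ∣ g ⟫
    ⟪⟫-* x k g = trans (∑-cong x (λ (a , b) → x∙yz≈y∙xz a k (g b))) (∑-* x k _)

    ⟪⟫-*ʳ : ∀ (x : Combination B) g k → ⟪ x ∣ (λ b → g b * k) ⟫ ≈ ⟪ x ∣ g ⟫ * k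
    ⟪⟫-*ʳ x g k = trans (⟪⟫-cong x (λ b → *-comm (g b) k)) (trans (⟪⟫-* x k g) (*-comm k _))

  ⟪⟫-swap : ∀ {B C : Set} (x : Combination B) (y : Combination C) (G : B → C → K) →
            ⟪ x ∣ (λ b → ⟪ y ∣ G b ⟫) ⟫ ≈ ⟪ y ∣ (λ c → ⟪ x ∣ (λ b → G b c) ⟫) ⟫
  ⟪⟫-swap x y G = begin
    ∑ x (λ (a , b) → a * ⟪ y ∣ G b ⟫)               ≈⟨ ∑-cong x (λ (a , b) → sym (⟪⟫-* y a (G b))) ⟩
    ∑ x (λ (a , b) → ∑ y (λ (a′ , c) → a′ * (a * G b c))) ≈⟨ ∑-swap x y _ ⟩
    ∑ y (λ (a′ , c) → ∑ x (λ (a , b) → a′ * (a * G b c))) ≈⟨ ∑-cong y (λ (a′ , c) → ∑-* x a′ _) ⟩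
    ⟪ y ∣ (λ c → ⟪ x ∣ (λ b → G b c) ⟫) ⟫ ∎

  ⟪⟫-scaled-map : ∀ {B C : Set} a (f : B → C) (y : Combination B) g →
                  ⟪ map (λ (b , n) → (a * b , f n)) y ∣ g ⟫ ≈ a * ⟪ y ∣ (λ n → g (f n)) ⟫
  ⟪⟫-scaled-map a f y g =
    trans (reflexive (∑-map _ y _)) (trans (∑-cong y (λ (b , n) → *-assoc a b (g (f n)))) (∑-* y a _))

  ⟪⟫-singleton : ∀ {B : Set} (b : B) g → ⟪ (1# , b) ∷ [] ∣ g ⟫ ≈ g b
  ⟪⟫-singleton b g = trans (+-identityʳ _) (*-identityˡ _)

  ∑-⟪⟫-swap : ∀ {A B : Set} (L : List A) (x : Combination B) (G : A → B → K) →
              ∑ L (λ w → ⟪ x ∣ G w ⟫) ≈ ⟪ x ∣ (λ b → ∑ L (λ w → G w b)) ⟫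
  ∑-⟪⟫-swap L x G = trans (∑-swap L x _) (∑-cong x (λ (a , b) → ∑-* L a (λ w → G w b)))

  ⟪⟫-concatMap : ∀ {B C : Set} (F : K × B → Combination C) (x : Combination B) g G →
                 (∀ a b → ⟪ F (a , b) ∣ g ⟫ ≈ a * G b) → ⟪ concatMap F x ∣ g ⟫ ≈ ⟪ x ∣ G ⟫
  ⟪⟫-concatMap F x g G F≈ = trans (∑-concatMap F x _) (∑-cong x (λ (a , b) → F≈ a b))

  bilinear : ∀ {B C D : Set} → (B → C → D) → Combination B → Combination C → Combination D
  bilinear f x y = concatMap (λ (a , m) → map (λ (b , n) → (a * b , f m n)) y) x

  ⟪⟫-bilinear : ∀ {B C D : Set} (f : B → C → D) x y g →
                ⟪ bilinear f x y ∣ g ⟫ ≈ ⟪ x ∣ (λ m → ⟪ y ∣ (λ n → g (f m n)) ⟫) ⟫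
  ⟪⟫-bilinear f x y g = ⟪⟫-concatMap _ x g _ (λ a m → ⟪⟫-scaled-map a (f m) y g)

  All-bilinear : ∀ {B C D : Set} {P : B → Set} {Q : C → Set} {S : D → Set} (f : B → C → D) →
                 (∀ {m n} → P m → Q n → S (f m n)) → ∀ {x y} →
                 All (λ e → P (proj₂ e)) x → All (λ e → Q (proj₂ e)) y → All (λ e → S (proj₂ e)) (bilinear f x y)
  All-bilinear f PQ⇒S px py = All-concatMap (All.map (λ pm → All.map⁺ (All.map (λ qn → PQ⇒S pm qn) py)) px)

  module Kronecker {A : Set} (_≟_ : DecidableEquality A) where
    δ : A → A → K
    δ x y with x ≟ y
    ... | yes _ = 1#
    ... | no  _ = 0#

    δ-refl : ∀ x → δ x x ≈ 1#
    δ-refl x with x ≟ x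
    ... | yes _   = refl
    ... | no  x≢x = contradiction ≡.refl x≢x

    δ-≢ : ∀ {x y} → ¬ x ≡ y → δ x y ≈ 0#
    δ-≢ {x} {y} x≢y with x ≟ y
    ... | yes x≡y = contradiction x≡y x≢y
    ... | no  _   = refl

    ∑-δ : ∀ {L} → Unique L → ∀ {x} → x ∈ L → (g : A → K) → ∑ L (λ y → δ x y * g y) ≈ g x
    ∑-δ {x ∷ L} (x∉L ∷ _) (here ≡.refl) g = begin
      δ x x * g x + ∑ L (λ y → δ x y * g y) ≈⟨ +-cong (*-congʳ (δ-refl x)) (∑-cong-All x∉L (λ x≢y → *-congʳ (δ-≢ x≢y))) ⟩
      1# * g x + ∑ L (λ y → 0# * g y)       ≈⟨ +-cong (*-identityˡ (g x)) (∑-zero L (λ y → zeroˡ (g y))) ⟩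
      g x + 0#                              ≈⟨ +-identityʳ (g x) ⟩
      g x ∎
    ∑-δ {y ∷ L} (y∉L ∷ L!) {x} (there x∈L) g = begin
      δ x y * g y + ∑ L (λ z → δ x z * g z) ≈⟨ +-cong (*-congʳ (δ-≢ x≢y)) (∑-δ L! x∈L g) ⟩
      0# * g y + g x                        ≈⟨ trans (+-congʳ (zeroˡ (g y))) (+-identityˡ (g x)) ⟩
      g x ∎
      where
      x≢y : ¬ x ≡ y
      x≢y x≡y = All.lookup y∉L x∈L (≡.sym x≡y)

module Combinatorics {c ℓ} (R : CommutativeRing c ℓ) (N : ℕ) where
  open HopfDefs R N
  open ≡.≡-Reasoning

  GenWord : Set
  GenWord = Letter × Letter × Word

  toWord : GenWord → Word
  toWord (a , b , r) = a ∷ b ∷ r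

  toWord-injective : ∀ {p q} → toWord p ≡ toWord q → p ≡ q
  toWord-injective ≡.refl = ≡.refl

  reverseGenWord : GenWord → GenWord
  reverseGenWord p with reverse (toWord p)
  ... | a ∷ b ∷ r = a , b , r
  ... | _         = p   -- unreachable: reversal preserves length

  toWord-reverseGenWord : ∀ p → toWord (reverseGenWord p) ≡ reverse (toWord p)
  toWord-reverseGenWord p with reverse (toWord p) in eq
  ... | _ ∷ _ ∷ _ = ≡.refl
  ... | []        = contradiction (≡.trans (≡.sym (List.length-reverse (toWord p))) (≡.cong length eq)) λ ()
  ... | _ ∷ []    = contradiction (≡.trans (≡.sym (List.length-reverse (toWord p))) (≡.cong length eq)) λ ()

  reverseGenWord-involutive : ∀ p → reverseGenWord (reverseGenWord p) ≡ p
  reverseGenWord-involutive p = toWord-injective (begin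
    toWord (reverseGenWord (reverseGenWord p)) ≡⟨ toWord-reverseGenWord (reverseGenWord p) ⟩
    reverse (toWord (reverseGenWord p))        ≡⟨ ≡.cong reverse (toWord-reverseGenWord p) ⟩
    reverse (reverse (toWord p))               ≡⟨ List.reverse-involutive (toWord p) ⟩
    toWord p ∎)

  revGen : Gen → Gen
  revGen (i , p) = i , reverseGenWord p

  sGen≡basis : ∀ g → sGen g ≡ basis (revGen g ∷ [])
  sGen≡basis (i , p) = ≡.cong (Y i) (≡.sym (toWord-reverseGenWord p))

  revMon : Mon → Mon
  revMon m = map revGen (reverse m)

  revMon-involutive : ∀ m → revMon (revMon m) ≡ m
  revMon-involutive m = begin
    map revGen (reverse (map revGen (reverse m))) ≡⟨ ≡.cong (map revGen) (List.reverse-map revGen (reverse m)) ⟨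
    map revGen (map revGen (reverse (reverse m))) ≡⟨ ≡.cong (λ m′ → map revGen (map revGen m′)) (List.reverse-involutive m) ⟩
    map revGen (map revGen m)                     ≡⟨ List.map-∘ m ⟨
    map (λ g → revGen (revGen g)) m               ≡⟨ List.map-cong (λ (i , p) → ≡.cong (i ,_) (reverseGenWord-involutive p)) m ⟩
    map (λ g → g) m                               ≡⟨ List.map-id m ⟩
    m ∎

  revMon-++ : ∀ m n → revMon (m ++ n) ≡ revMon n ++ revMon m
  revMon-++ m n = ≡.trans (≡.cong (map revGen) (List.reverse-++ m n)) (List.map-++ revGen (reverse n) (reverse m))

  reverseBlocks : List Word → List Word
  reverseBlocks Bs = reverse (map reverse Bs)

  reverseBlocks-∷ : ∀ B Bs → reverseBlocks (B ∷ Bs) ≡ reverseBlocks Bs ∷ʳ reverse B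
  reverseBlocks-∷ B Bs = List.unfold-reverse (reverse B) (map reverse Bs)

  reverseBlocks-involutive : ∀ Bs → reverseBlocks (reverseBlocks Bs) ≡ Bs
  reverseBlocks-involutive Bs = begin
    reverse (map reverse (reverse (map reverse Bs))) ≡⟨ ≡.cong reverse (List.reverse-map reverse (map reverse Bs)) ⟩
    reverse (reverse (map reverse (map reverse Bs))) ≡⟨ List.reverse-involutive _ ⟩
    map reverse (map reverse Bs)                     ≡⟨ List.map-∘ Bs ⟨
    map (λ B → reverse (reverse B)) Bs               ≡⟨ List.map-cong List.reverse-involutive Bs ⟩
    map (λ B → B) Bs                                 ≡⟨ List.map-id Bs ⟩
    Bs ∎

  length-reverseBlocks : ∀ Bs → length (reverseBlocks Bs) ≡ length Bs
  length-reverseBlocks Bs = ≡.trans (List.length-reverse (map reverse Bs)) (List.length-map reverse Bs)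

  zipWith-∷ʳ : ∀ {a} {A B : Set} {C : Set a} (f : A → B → C) {xs ys} x y → length xs ≡ length ys →
               zipWith f (xs ∷ʳ x) (ys ∷ʳ y) ≡ zipWith f xs ys ∷ʳ f x y
  zipWith-∷ʳ f {[]}     {[]}     x y _ = ≡.refl
  zipWith-∷ʳ f {a ∷ xs} {b ∷ ys} x y e = ≡.cong (f a b ∷_) (zipWith-∷ʳ f x y (ℕ.suc-injective e))

  prepend : Letter → List Word → List (List Word)
  prepend x []       = ((x ∷ []) ∷ []) ∷ []
  prepend x (B ∷ Bs) = ((x ∷ []) ∷ B ∷ Bs) ∷ ((x ∷ B) ∷ Bs) ∷ []

  splits-∷ : ∀ x xs → splits (x ∷ xs) ≡ concatMap (prepend x) (splits xs)
  splits-∷ x xs = List.concatMap-cong (λ { [] → ≡.refl ; (B ∷ Bs) → ≡.refl }) (splits xs)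

  concat-splits : ∀ u → All (λ Bs → concat Bs ≡ u) (splits u)
  concat-splits []       = ≡.refl ∷ []
  concat-splits (x ∷ xs) rewrite splits-∷ x xs = All-concatMap (All.map concat-prepend (concat-splits xs))
    where
    concat-prepend : ∀ {Bs} → concat Bs ≡ xs → All (λ Cs → concat Cs ≡ x ∷ xs) (prepend x Bs)
    concat-prepend {[]}     e = ≡.cong (x ∷_) e ∷ []
    concat-prepend {B ∷ Bs} e = ≡.cong (x ∷_) e ∷ ≡.cong (x ∷_) e ∷ []

  mapLast : (Word → Word) → List Word → List Word
  mapLast f []           = []
  mapLast f (B ∷ [])     = f B ∷ []
  mapLast f (B ∷ C ∷ Cs) = B ∷ mapLast f (C ∷ Cs)

  mapLast-∷ʳ : ∀ f Bs C → mapLast f (Bs ∷ʳ C) ≡ Bs ∷ʳ f C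
  mapLast-∷ʳ f []           C = ≡.refl
  mapLast-∷ʳ f (B ∷ [])     C = ≡.refl
  mapLast-∷ʳ f (B ∷ C′ ∷ Cs) C = ≡.cong (B ∷_) (mapLast-∷ʳ f (C′ ∷ Cs) C)

  length-wordsOfLength : ∀ q → All (λ v → length v ≡ q) (wordsOfLength q)
  length-wordsOfLength zero    = ≡.refl ∷ []
  length-wordsOfLength (suc q) =
    All-concatMap (All.universal (λ j → All.map⁺ (All.map (≡.cong suc) (length-wordsOfLength q))) (allFin N))

  Yprod : Word → List Word → H
  Yprod v Bs = prodH (zipWith Y v Bs)

module Incidence {c ℓ} (R : CommutativeRing c ℓ) (N : ℕ) where
  open HopfDefs R N
  open CommutativeRing R renaming (Carrier to K) hiding (zero)
  open Linear R
  open Kronecker _≟Mon_ using () renaming (δ to δᴹ; ∑-δ to ∑-δᴹ)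
  open Kronecker (Fin._≟_ {N}) using (δ; ∑-δ)
  open Combinatorics R N
  open import Algebra.Properties.CommutativeSemigroup +-commutativeSemigroup using (interchange)
  open import Relation.Binary.Reasoning.Setoid setoid

  ⟪_∣_⟫₂ : H⊗H → (Mon → Mon → K) → K
  ⟪ t ∣ G ⟫₂ = ⟪ t ∣ (λ (m , n) → G m n) ⟫

  ⟪⟫-basis : ∀ m g → ⟪ basis m ∣ g ⟫ ≈ g m
  ⟪⟫-basis = ⟪⟫-singleton

  ⟪⟫-oneT : ∀ G → ⟪ oneT ∣ G ⟫₂ ≈ G [] []
  ⟪⟫-oneT G = ⟪⟫-singleton {B = Mon × Mon} ([] , []) (λ (m , n) → G m n)

  ⟪⟫-scale : ∀ a x g → ⟪ scale a x ∣ g ⟫ ≈ a * ⟪ x ∣ g ⟫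
  ⟪⟫-scale a x g = ⟪⟫-scaled-map a (λ m → m) x g

  ⟪⟫-scale₂ : ∀ a t G → ⟪ scale₂ a t ∣ G ⟫₂ ≈ a * ⟪ t ∣ G ⟫₂
  ⟪⟫-scale₂ a t G = ⟪⟫-scaled-map a (λ p → p) t _

  ⟪⟫-· : ∀ x y g → ⟪ x · y ∣ g ⟫ ≈ ⟪ x ∣ (λ m → ⟪ y ∣ (λ n → g (m ++ n)) ⟫) ⟫
  ⟪⟫-· = ⟪⟫-bilinear _++_

  ⟪⟫-⊗ : ∀ x y G → ⟪ x ⊗ y ∣ G ⟫₂ ≈ ⟪ x ∣ (λ m → ⟪ y ∣ G m ⟫) ⟫
  ⟪⟫-⊗ x y G = ⟪⟫-bilinear _,_ x y _

  ⟪⟫-·T : ∀ s t G → ⟪ s ·T t ∣ G ⟫₂ ≈ ⟪ s ∣ (λ m m′ → ⟪ t ∣ (λ n n′ → G (m ++ n) (m′ ++ n′)) ⟫₂) ⟫₂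
  ⟪⟫-·T s t G = ⟪⟫-bilinear (λ (m , m′) (n , n′) → (m ++ n , m′ ++ n′)) s t _

  ⟪⟫-ext : ∀ f x g → ⟪ ext f x ∣ g ⟫ ≈ ⟪ x ∣ (λ m → ⟪ f m ∣ g ⟫) ⟫
  ⟪⟫-ext f x g = ⟪⟫-concatMap _ x g _ (λ a m → ⟪⟫-scale a (f m) g)

  ⟪⟫-ext→T : ∀ f x G → ⟪ ext→T f x ∣ G ⟫₂ ≈ ⟪ x ∣ (λ m → ⟪ f m ∣ G ⟫₂) ⟫
  ⟪⟫-ext→T f x G = ⟪⟫-concatMap _ x _ _ (λ a m → ⟪⟫-scale₂ a (f m) G)

  ⟪⟫-extT→ : ∀ f t g → ⟪ extT→ f t ∣ g ⟫ ≈ ⟪ t ∣ (λ m n → ⟪ f m n ∣ g ⟫) ⟫₂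
  ⟪⟫-extT→ f t g = ⟪⟫-concatMap _ t g _ (λ a (m , n) → ⟪⟫-scale a (f m n) g)

  ⟪⟫-extT→T : ∀ f t G → ⟪ extT→T f t ∣ G ⟫₂ ≈ ⟪ t ∣ (λ m n → ⟪ f m n ∣ G ⟫₂) ⟫₂
  ⟪⟫-extT→T f t G = ⟪⟫-concatMap _ t _ _ (λ a (m , n) → ⟪⟫-scale₂ a (f m n) G)

  ⟪⟫-mH : ∀ t g → ⟪ mH t ∣ g ⟫ ≈ ⟪ t ∣ (λ m n → g (m ++ n)) ⟫₂
  ⟪⟫-mH t g = trans (⟪⟫-extT→ (λ m n → basis (m ++ n)) t g) (⟪⟫-cong t (λ (m , n) → ⟪⟫-basis (m ++ n) g))

  ⟪⟫-mop : ∀ t g → ⟪ mop t ∣ g ⟫ ≈ ⟪ t ∣ (λ m n → g (n ++ m)) ⟫₂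
  ⟪⟫-mop t g = trans (⟪⟫-extT→ (λ m n → basis (n ++ m)) t g) (⟪⟫-cong t (λ (m , n) → ⟪⟫-basis (n ++ m) g))

  ⟪⟫-ΔH : ∀ x G → ⟪ ΔH x ∣ G ⟫₂ ≈ ⟪ x ∣ (λ m → ⟪ ΔMon m ∣ G ⟫₂) ⟫
  ⟪⟫-ΔH = ⟪⟫-ext→T ΔMon

  εH≈⟪⟫ : ∀ x → εH x ≈ ⟪ x ∣ εMon ⟫
  εH≈⟪⟫ []            = refl
  εH≈⟪⟫ ((a , m) ∷ x) = +-congˡ (εH≈⟪⟫ x)

  coeff≈⟪⟫ : ∀ x w → coeff x w ≈ ⟪ x ∣ (λ m → δᴹ m w) ⟫
  coeff≈⟪⟫ []            w = refl
  coeff≈⟪⟫ ((a , m) ∷ x) w with m ≟Mon w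
  ... | yes _ = +-cong (sym (*-identityʳ a)) (coeff≈⟪⟫ x w)
  ... | no  _ = +-cong (sym (zeroʳ a)) (coeff≈⟪⟫ x w)

  coeff₂≈⟪⟫ : ∀ t w₁ w₂ → coeff₂ t w₁ w₂ ≈ ⟪ t ∣ (λ m n → δᴹ m w₁ * δᴹ n w₂) ⟫₂
  coeff₂≈⟪⟫ []                w₁ w₂ = refl
  coeff₂≈⟪⟫ ((a , m , n) ∷ t) w₁ w₂ with m ≟Mon w₁ | n ≟Mon w₂
  ... | yes _ | yes _ = +-cong (sym (trans (*-congˡ (*-identityˡ 1#)) (*-identityʳ a))) (coeff₂≈⟪⟫ t w₁ w₂)
  ... | yes _ | no  _ = +-cong (sym (trans (*-congˡ (zeroʳ 1#)) (zeroʳ a))) (coeff₂≈⟪⟫ t w₁ w₂)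
  ... | no  _ | yes _ = +-cong (sym (trans (*-congˡ (zeroˡ 1#)) (zeroʳ a))) (coeff₂≈⟪⟫ t w₁ w₂)
  ... | no  _ | no  _ = +-cong (sym (trans (*-congˡ (zeroˡ 0#)) (zeroʳ a))) (coeff₂≈⟪⟫ t w₁ w₂)

  ≋⇒≈H : ∀ {x y} → x ≋ y → x ≈H y
  ≋⇒≈H {x} {y} x≋y w = trans (coeff≈⟪⟫ x w) (trans (x≋y _) (sym (coeff≈⟪⟫ y w)))

  ≋⇒≈T : ∀ {s t} → s ≋ t → s ≈T t
  ≋⇒≈T {s} {t} s≋t w₁ w₂ = trans (coeff₂≈⟪⟫ s w₁ w₂) (trans (s≋t _) (sym (coeff₂≈⟪⟫ t w₁ w₂)))

  ⟪⟫-expand : ∀ {L} → Unique L → ∀ x → All (λ e → proj₂ e ∈ L) x →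
              ∀ g → ⟪ x ∣ g ⟫ ≈ ∑ L (λ w → coeff x w * g w)
  ⟪⟫-expand {L} L! x x⊆L g = sym (begin
    ∑ L (λ w → coeff x w * g w)
      ≈⟨ ∑-cong L (λ w → trans (*-congʳ (coeff≈⟪⟫ x w)) (trans (*-comm _ _) (sym (⟪⟫-* x (g w) _)))) ⟩
    ∑ L (λ w → ⟪ x ∣ (λ m → g w * δᴹ m w) ⟫)
      ≈⟨ ∑-⟪⟫-swap L x _ ⟩
    ⟪ x ∣ (λ m → ∑ L (λ w → g w * δᴹ m w)) ⟫
      ≈⟨ ⟪⟫-cong-All x⊆L (λ m∈L → trans (∑-cong L (λ w → *-comm _ _)) (∑-δᴹ L! m∈L g)) ⟩
    ⟪ x ∣ g ⟫ ∎)

  ≈H⇒≋ : ∀ {x y} → x ≈H y → x ≋ y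
  ≈H⇒≋ {x} {y} x≈y g = begin
    ⟪ x ∣ g ⟫
      ≈⟨ ⟪⟫-expand L! x (All.tabulate (λ e∈x → ∈-deduplicate⁺ _≟Mon_ (∈-++⁺ˡ (∈-map⁺ proj₂ e∈x)))) g ⟩
    ∑ L (λ w → coeff x w * g w)
      ≈⟨ ∑-cong L (λ w → *-congʳ (x≈y w)) ⟩
    ∑ L (λ w → coeff y w * g w)
      ≈⟨ ⟪⟫-expand L! y (All.tabulate (λ e∈y → ∈-deduplicate⁺ _≟Mon_ (∈-++⁺ʳ (map proj₂ x) (∈-map⁺ proj₂ e∈y)))) g ⟨
    ⟪ y ∣ g ⟫ ∎
    where
    L : List Mon
    L = deduplicate _≟Mon_ (map proj₂ x ++ map proj₂ y)
    L! : Unique L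
    L! = Unique.deduplicate-! _≟Mon_ _

  ⟪⟫-prodH-sGen : ∀ l g → ⟪ prodH (map sGen l) ∣ g ⟫ ≈ g (map revGen l)
  ⟪⟫-prodH-sGen []       g = ⟪⟫-basis [] g
  ⟪⟫-prodH-sGen (h ∷ l)  g = begin
    ⟪ sGen h · prodH (map sGen l) ∣ g ⟫
      ≈⟨ ⟪⟫-· (sGen h) _ g ⟩
    ⟪ sGen h ∣ (λ m → ⟪ prodH (map sGen l) ∣ (λ n → g (m ++ n)) ⟫) ⟫
      ≡⟨ ≡.cong (λ y → ⟪ y ∣ _ ⟫) (sGen≡basis h) ⟩
    ⟪ basis (revGen h ∷ []) ∣ (λ m → ⟪ prodH (map sGen l) ∣ (λ n → g (m ++ n)) ⟫) ⟫
      ≈⟨ ⟪⟫-basis (revGen h ∷ []) (λ m → ⟪ prodH (map sGen l) ∣ (λ n → g (m ++ n)) ⟫) ⟩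
    ⟪ prodH (map sGen l) ∣ (λ n → g (revGen h ∷ n)) ⟫
      ≈⟨ ⟪⟫-prodH-sGen l _ ⟩
    g (revGen h ∷ map revGen l) ∎

  ⟪⟫-sMon : ∀ m g → ⟪ sMon m ∣ g ⟫ ≈ g (revMon m)
  ⟪⟫-sMon m g rewrite ≡.sym (List.reverse-map sGen m) = ⟪⟫-prodH-sGen (reverse m) g

  ⟪⟫-sH : ∀ x g → ⟪ sH x ∣ g ⟫ ≈ ⟪ x ∣ (λ m → g (revMon m)) ⟫
  ⟪⟫-sH x g = trans (⟪⟫-ext sMon x g) (⟪⟫-cong x (λ m → ⟪⟫-sMon m g))

  ⟪⟫-s⊗s : ∀ t G → ⟪ s⊗s t ∣ G ⟫₂ ≈ ⟪ t ∣ (λ m n → G (revMon m) (revMon n)) ⟫₂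
  ⟪⟫-s⊗s t G = trans (⟪⟫-extT→T _ t G) (⟪⟫-cong t (λ (m , n) →
    trans (⟪⟫-⊗ (sMon m) (sMon n) G) (trans (⟪⟫-sMon m _) (⟪⟫-sMon n _))))

  mop≈s∘mH∘s⊗s : ∀ t → mop t ≈H sH (mH (s⊗s t))
  mop≈s∘mH∘s⊗s t = ≋⇒≈H {mop t} {sH (mH (s⊗s t))} λ g → sym (begin
    ⟪ sH (mH (s⊗s t)) ∣ g ⟫
      ≈⟨ ⟪⟫-sH (mH (s⊗s t)) g ⟩
    ⟪ mH (s⊗s t) ∣ (λ m → g (revMon m)) ⟫
      ≈⟨ ⟪⟫-mH (s⊗s t) _ ⟩
    ⟪ s⊗s t ∣ (λ m n → g (revMon (m ++ n))) ⟫₂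
      ≈⟨ ⟪⟫-s⊗s t _ ⟩
    ⟪ t ∣ (λ m n → g (revMon (revMon m ++ revMon n))) ⟫₂
      ≈⟨ ⟪⟫-cong t (λ (m , n) → reflexive (≡.cong g (revMon-revMon-++ m n))) ⟩
    ⟪ t ∣ (λ m n → g (n ++ m)) ⟫₂
      ≈⟨ ⟪⟫-mop t g ⟨
    ⟪ mop t ∣ g ⟫ ∎)
    where
    revMon-revMon-++ : ∀ m n → revMon (revMon m ++ revMon n) ≡ n ++ m
    revMon-revMon-++ m n = ≡.trans (revMon-++ (revMon m) (revMon n)) (≡.cong₂ _++_ (revMon-involutive n) (revMon-involutive m))

  -- Interval partitions

  -- x either forms a block of its own or joins the first block.
  onCons : Letter → (List Word → K) → List Word → K
  onCons x F []       = F ((x ∷ []) ∷ [])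
  onCons x F (B ∷ Bs) = F ((x ∷ []) ∷ B ∷ Bs) + F ((x ∷ B) ∷ Bs)

  ∑-splits-∷ : ∀ x xs F → ∑ (splits (x ∷ xs)) F ≈ ∑ (splits xs) (onCons x F)
  ∑-splits-∷ x xs F rewrite splits-∷ x xs = trans (∑-concatMap (prepend x) (splits xs) F) (∑-cong (splits xs) ∑-prepend)
    where
    ∑-prepend : ∀ Bs → ∑ (prepend x Bs) F ≈ onCons x F Bs
    ∑-prepend []       = +-identityʳ _
    ∑-prepend (B ∷ Bs) = +-congˡ (+-identityʳ _)

  onSnoc : Letter → (List Word → K) → List Word → K
  onSnoc x F []       = F ((x ∷ []) ∷ [])
  onSnoc x F (B ∷ Bs) = F ((B ∷ Bs) ∷ʳ (x ∷ [])) + F (mapLast (_∷ʳ x) (B ∷ Bs))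

  ∑-splits-∷ʳ : ∀ w x F → ∑ (splits (w ∷ʳ x)) F ≈ ∑ (splits w) (onSnoc x F)
  ∑-splits-∷ʳ []      x F = refl
  ∑-splits-∷ʳ (y ∷ w) x F = begin
    ∑ (splits (y ∷ w ∷ʳ x)) F           ≈⟨ ∑-splits-∷ y (w ∷ʳ x) F ⟩
    ∑ (splits (w ∷ʳ x)) (onCons y F)    ≈⟨ ∑-splits-∷ʳ w x (onCons y F) ⟩
    ∑ (splits w) (onSnoc x (onCons y F)) ≈⟨ ∑-cong (splits w) commute ⟩
    ∑ (splits w) (onCons y (onSnoc x F)) ≈⟨ ∑-splits-∷ y w (onSnoc x F) ⟨
    ∑ (splits (y ∷ w)) (onSnoc x F) ∎
    where
    onCons-mapLast : ∀ B Bs → onCons y F (mapLast (_∷ʳ x) (B ∷ Bs)) ≡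
                     F ((y ∷ []) ∷ mapLast (_∷ʳ x) (B ∷ Bs)) + F (mapLast (_∷ʳ x) ((y ∷ B) ∷ Bs))
    onCons-mapLast B []       = ≡.refl
    onCons-mapLast B (C ∷ Cs) = ≡.refl
    commute : ∀ Bs → onSnoc x (onCons y F) Bs ≈ onCons y (onSnoc x F) Bs
    commute []       = refl
    commute (B ∷ Bs) = trans (+-congˡ (reflexive (onCons-mapLast B Bs))) (interchange _ _ _ _)

  ∑-splits-reverse : ∀ u F → ∑ (splits (reverse u)) F ≈ ∑ (splits u) (λ Bs → F (reverseBlocks Bs))
  ∑-splits-reverse []       F = refl
  ∑-splits-reverse (x ∷ xs) F = begin
    ∑ (splits (reverse (x ∷ xs))) F                    ≡⟨ ≡.cong (λ w → ∑ (splits w) F) (List.unfold-reverse x xs) ⟩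
    ∑ (splits (reverse xs ∷ʳ x)) F                     ≈⟨ ∑-splits-∷ʳ (reverse xs) x F ⟩
    ∑ (splits (reverse xs)) (onSnoc x F)               ≈⟨ ∑-splits-reverse xs (onSnoc x F) ⟩
    ∑ (splits xs) (λ Bs → onSnoc x F (reverseBlocks Bs)) ≈⟨ ∑-cong (splits xs) onSnoc-reverseBlocks ⟩
    ∑ (splits xs) (onCons x (λ Bs → F (reverseBlocks Bs))) ≈⟨ ∑-splits-∷ x xs _ ⟨
    ∑ (splits (x ∷ xs)) (λ Bs → F (reverseBlocks Bs)) ∎
    where
    onSnoc-∷ʳ : ∀ Cs C → onSnoc x F (Cs ∷ʳ C) ≡ F ((Cs ∷ʳ C) ∷ʳ (x ∷ [])) + F (Cs ∷ʳ (C ∷ʳ x))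
    onSnoc-∷ʳ []       C = ≡.refl
    onSnoc-∷ʳ (B ∷ Cs) C = ≡.cong (F _ +_) (≡.cong F (mapLast-∷ʳ (_∷ʳ x) (B ∷ Cs) C))
    onSnoc-reverseBlocks : ∀ Bs → onSnoc x F (reverseBlocks Bs) ≈ onCons x (λ Bs → F (reverseBlocks Bs)) Bs
    onSnoc-reverseBlocks []       = refl
    onSnoc-reverseBlocks (B ∷ Bs) = begin
      onSnoc x F (reverseBlocks (B ∷ Bs))                     ≡⟨ ≡.cong (onSnoc x F) (reverseBlocks-∷ B Bs) ⟩
      onSnoc x F (reverseBlocks Bs ∷ʳ reverse B)               ≡⟨ onSnoc-∷ʳ (reverseBlocks Bs) (reverse B) ⟩
      F ((reverseBlocks Bs ∷ʳ reverse B) ∷ʳ (x ∷ [])) + F (reverseBlocks Bs ∷ʳ (reverse B ∷ʳ x))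
        ≡⟨ ≡.cong₂ (λ Cs Cs′ → F Cs + F Cs′)
                   (≡.sym (≡.trans (reverseBlocks-∷ (x ∷ []) (B ∷ Bs)) (≡.cong (_∷ʳ (x ∷ [])) (reverseBlocks-∷ B Bs))))
                   (≡.sym (≡.trans (reverseBlocks-∷ (x ∷ B) Bs) (≡.cong (λ C → reverseBlocks Bs ∷ʳ C) (List.unfold-reverse x B)))) ⟩
      F (reverseBlocks ((x ∷ []) ∷ B ∷ Bs)) + F (reverseBlocks ((x ∷ B) ∷ Bs)) ∎

  -- Words of a given length

  ∑-wordsOfLength-∷ : ∀ q F → ∑ (wordsOfLength (suc q)) F ≈ ∑ (allFin N) (λ j → ∑ (wordsOfLength q) (λ v → F (j ∷ v)))
  ∑-wordsOfLength-∷ q F = trans (∑-concatMap (λ j → map (j ∷_) (wordsOfLength q)) (allFin N) F)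
                                (∑-cong (allFin N) (λ j → reflexive (∑-map (j ∷_) (wordsOfLength q) F)))

  ∑-wordsOfLength-∷ʳ : ∀ q F → ∑ (wordsOfLength (suc q)) F ≈ ∑ (wordsOfLength q) (λ v → ∑ (allFin N) (λ j → F (v ∷ʳ j)))
  ∑-wordsOfLength-∷ʳ zero    F = trans (∑-wordsOfLength-∷ zero F) (trans (∑-cong (allFin N) (λ j → +-identityʳ _)) (sym (+-identityʳ _)))
  ∑-wordsOfLength-∷ʳ (suc q) F = begin
    ∑ (wordsOfLength (suc (suc q))) F
      ≈⟨ ∑-wordsOfLength-∷ (suc q) F ⟩
    ∑ (allFin N) (λ j → ∑ (wordsOfLength (suc q)) (λ v → F (j ∷ v)))
      ≈⟨ ∑-cong (allFin N) (λ j → ∑-wordsOfLength-∷ʳ q _) ⟩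
    ∑ (allFin N) (λ j → ∑ (wordsOfLength q) (λ v → ∑ (allFin N) (λ k → F (j ∷ v ∷ʳ k))))
      ≈⟨ ∑-wordsOfLength-∷ q _ ⟨
    ∑ (wordsOfLength (suc q)) (λ v → ∑ (allFin N) (λ j → F (v ∷ʳ j))) ∎

  ∑-wordsOfLength-reverse : ∀ q F → ∑ (wordsOfLength q) F ≈ ∑ (wordsOfLength q) (λ v → F (reverse v))
  ∑-wordsOfLength-reverse zero    F = refl
  ∑-wordsOfLength-reverse (suc q) F = sym (begin
    ∑ (wordsOfLength (suc q)) (λ v → F (reverse v))
      ≈⟨ ∑-wordsOfLength-∷ q _ ⟩
    ∑ (allFin N) (λ j → ∑ (wordsOfLength q) (λ v → F (reverse (j ∷ v))))
      ≈⟨ ∑-cong (allFin N) (λ j → ∑-cong (wordsOfLength q) (λ v → reflexive (≡.cong F (List.unfold-reverse j v)))) ⟩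
    ∑ (allFin N) (λ j → ∑ (wordsOfLength q) (λ v → F (reverse v ∷ʳ j)))
      ≈⟨ ∑-cong (allFin N) (λ j → ∑-wordsOfLength-reverse q (λ v → F (v ∷ʳ j))) ⟨
    ∑ (allFin N) (λ j → ∑ (wordsOfLength q) (λ v → F (v ∷ʳ j)))
      ≈⟨ ∑-swap (allFin N) (wordsOfLength q) _ ⟩
    ∑ (wordsOfLength q) (λ v → ∑ (allFin N) (λ j → F (v ∷ʳ j)))
      ≈⟨ ∑-wordsOfLength-∷ʳ q F ⟨
    ∑ (wordsOfLength (suc q)) F ∎)

  -- The coproduct and the reversal

  ⟪⟫-Y-reverse : ∀ i w h → ⟪ Y i w ∣ (λ m → h (revMon m)) ⟫ ≈ ⟪ Y i (reverse w) ∣ h ⟫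
  ⟪⟫-Y-reverse i []          h = refl
  ⟪⟫-Y-reverse i (j ∷ [])    h with i Fin.≟ j
  ... | yes _ = refl
  ... | no  _ = refl
  ⟪⟫-Y-reverse i (a ∷ b ∷ r) h = begin
    ⟪ Y i (a ∷ b ∷ r) ∣ (λ m → h (revMon m)) ⟫ ≈⟨ ⟪⟫-basis ((i , a , b , r) ∷ []) (λ m → h (revMon m)) ⟩
    h (revGen (i , a , b , r) ∷ [])             ≈⟨ ⟪⟫-basis _ h ⟨
    ⟪ basis (revGen (i , a , b , r) ∷ []) ∣ h ⟫ ≡⟨ ≡.cong (λ y → ⟪ y ∣ h ⟫) (sGen≡basis (i , a , b , r)) ⟨
    ⟪ Y i (reverse (a ∷ b ∷ r)) ∣ h ⟫ ∎

  ⟪⟫-prodH-++ : ∀ L L′ k → ⟪ prodH (L ++ L′) ∣ k ⟫ ≈ ⟪ prodH L ∣ (λ m → ⟪ prodH L′ ∣ (λ n → k (m ++ n)) ⟫) ⟫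
  ⟪⟫-prodH-++ []      L′ k = sym (⟪⟫-basis [] (λ m → ⟪ prodH L′ ∣ (λ n → k (m ++ n)) ⟫))
  ⟪⟫-prodH-++ (x ∷ L) L′ k = begin
    ⟪ x · prodH (L ++ L′) ∣ k ⟫
      ≈⟨ ⟪⟫-· x _ k ⟩
    ⟪ x ∣ (λ m → ⟪ prodH (L ++ L′) ∣ (λ n → k (m ++ n)) ⟫) ⟫
      ≈⟨ ⟪⟫-cong x (λ m → ⟪⟫-prodH-++ L L′ _) ⟩
    ⟪ x ∣ (λ m → ⟪ prodH L ∣ (λ a → ⟪ prodH L′ ∣ (λ b → k (m ++ (a ++ b))) ⟫) ⟫) ⟫
      ≈⟨ ⟪⟫-cong x (λ m → ⟪⟫-cong (prodH L) (λ a → ⟪⟫-cong (prodH L′) (λ b →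
           reflexive (≡.cong k (≡.sym (List.++-assoc m a b)))))) ⟩
    ⟪ x ∣ (λ m → ⟪ prodH L ∣ (λ a → ⟪ prodH L′ ∣ (λ b → k ((m ++ a) ++ b)) ⟫) ⟫) ⟫
      ≈⟨ ⟪⟫-· x (prodH L) _ ⟨
    ⟪ x · prodH L ∣ (λ m → ⟪ prodH L′ ∣ (λ n → k (m ++ n)) ⟫) ⟫ ∎

  ⟪⟫-prodH-[_] : ∀ y k → ⟪ prodH (y ∷ []) ∣ k ⟫ ≈ ⟪ y ∣ k ⟫
  ⟪⟫-prodH-[ y ] k = trans (⟪⟫-· y oneH k) (⟪⟫-cong y (λ m →
    trans (⟪⟫-basis [] (λ n → k (m ++ n))) (reflexive (≡.cong k (List.++-identityʳ m)))))

  ⟪⟫-Yprod-reverse : ∀ v Bs → length v ≡ length Bs → ∀ k →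
    ⟪ Yprod v Bs ∣ (λ m → k (revMon m)) ⟫ ≈ ⟪ Yprod (reverse v) (reverseBlocks Bs) ∣ k ⟫
  ⟪⟫-Yprod-reverse []      []       _ k = refl
  ⟪⟫-Yprod-reverse (j ∷ v) (B ∷ Bs) e k = begin
    ⟪ Y j B · P ∣ (λ m → k (revMon m)) ⟫
      ≈⟨ ⟪⟫-· (Y j B) P _ ⟩
    ⟪ Y j B ∣ (λ m → ⟪ P ∣ (λ n → k (revMon (m ++ n))) ⟫) ⟫
      ≈⟨ ⟪⟫-cong (Y j B) (λ m → ⟪⟫-cong P (λ n → reflexive (≡.cong k (revMon-++ m n)))) ⟩
    ⟪ Y j B ∣ (λ m → ⟪ P ∣ (λ n → k (revMon n ++ revMon m)) ⟫) ⟫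
      ≈⟨ ⟪⟫-cong (Y j B) (λ m → ⟪⟫-Yprod-reverse v Bs (ℕ.suc-injective e) _) ⟩
    ⟪ Y j B ∣ (λ m → ⟪ Q ∣ (λ n → k (n ++ revMon m)) ⟫) ⟫
      ≈⟨ ⟪⟫-Y-reverse j B _ ⟩
    ⟪ Y j (reverse B) ∣ (λ m → ⟪ Q ∣ (λ n → k (n ++ m)) ⟫) ⟫
      ≈⟨ ⟪⟫-swap (Y j (reverse B)) Q _ ⟩
    ⟪ Q ∣ (λ n → ⟪ Y j (reverse B) ∣ (λ m → k (n ++ m)) ⟫) ⟫
      ≈⟨ ⟪⟫-cong Q (λ n → ⟪⟫-prodH-[ Y j (reverse B) ] _) ⟨
    ⟪ Q ∣ (λ n → ⟪ prodH (Y j (reverse B) ∷ []) ∣ (λ m → k (n ++ m)) ⟫) ⟫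
      ≈⟨ ⟪⟫-prodH-++ (zipWith Y (reverse v) (reverseBlocks Bs)) _ k ⟨
    ⟪ prodH (zipWith Y (reverse v) (reverseBlocks Bs) ∷ʳ Y j (reverse B)) ∣ k ⟫
      ≡⟨ ≡.cong (λ L → ⟪ prodH L ∣ k ⟫) zipWith-reverse ⟨
    ⟪ Yprod (reverse (j ∷ v)) (reverseBlocks (B ∷ Bs)) ∣ k ⟫ ∎
    where
    P = Yprod v Bs
    Q = Yprod (reverse v) (reverseBlocks Bs)
    zipWith-reverse : zipWith Y (reverse (j ∷ v)) (reverseBlocks (B ∷ Bs)) ≡ zipWith Y (reverse v) (reverseBlocks Bs) ∷ʳ Y j (reverse B)
    zipWith-reverse = ≡.trans (≡.cong₂ (zipWith Y) (List.unfold-reverse j v) (reverseBlocks-∷ B Bs))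
      (zipWith-∷ʳ Y j (reverse B) (≡.trans (List.length-reverse v) (≡.trans (ℕ.suc-injective e) (≡.sym (length-reverseBlocks Bs)))))

  ∑Δ : Word → (List Word → Word → K) → K
  ∑Δ u T = ∑ (splits u) (λ Bs → ∑ (wordsOfLength (length Bs)) (T Bs))

  ⟪⟫-Δgen : ∀ i p G → ⟪ Δgen (i , p) ∣ G ⟫₂ ≈ ∑Δ (toWord p) (λ Bs v → ⟪ Yprod v Bs ∣ (λ m → ⟪ Y i v ∣ G m ⟫) ⟫)
  ⟪⟫-Δgen i p G = trans (∑-concatMap _ (splits (toWord p)) _) (∑-cong (splits (toWord p)) (λ Bs →
    trans (∑-concatMap _ (wordsOfLength (length Bs)) _) (∑-cong (wordsOfLength (length Bs)) (λ v → ⟪⟫-⊗ (Yprod v Bs) (Y i v) G))))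

  ⟪⟫-Δgen-revGen : ∀ g G → ⟪ Δgen g ∣ G ⟫₂ ≈ ⟪ Δgen (revGen g) ∣ (λ m n → G (revMon m) (revMon n)) ⟫₂
  ⟪⟫-Δgen-revGen (i , p) G = sym (begin
    ⟪ Δgen (i , reverseGenWord p) ∣ G′ ⟫₂
      ≈⟨ ⟪⟫-Δgen i (reverseGenWord p) G′ ⟩
    ∑Δ (toWord (reverseGenWord p)) T′
      ≡⟨ ≡.cong (λ w → ∑Δ w T′) (toWord-reverseGenWord p) ⟩
    ∑Δ (reverse u) T′
      ≈⟨ ∑-splits-reverse u _ ⟩
    ∑ (splits u) (λ Bs → ∑ (W (length (reverseBlocks Bs))) (T′ (reverseBlocks Bs)))
      ≈⟨ ∑-cong (splits u) (λ Bs → reflexive (≡.cong (λ q → ∑ (W q) (T′ (reverseBlocks Bs))) (length-reverseBlocks Bs))) ⟩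
    ∑ (splits u) (λ Bs → ∑ (W (length Bs)) (T′ (reverseBlocks Bs)))
      ≈⟨ ∑-cong (splits u) (λ Bs → ∑-wordsOfLength-reverse (length Bs) _) ⟩
    ∑ (splits u) (λ Bs → ∑ (W (length Bs)) (λ v → T′ (reverseBlocks Bs) (reverse v)))
      ≈⟨ ∑-cong (splits u) (λ Bs → ∑-cong-All (length-wordsOfLength (length Bs)) (λ {v} → T′≈T Bs {v})) ⟩
    ∑Δ u T
      ≈⟨ ⟪⟫-Δgen i p G ⟨
    ⟪ Δgen (i , p) ∣ G ⟫₂ ∎)
    where
    u = toWord p
    W = wordsOfLength
    G′ : Mon → Mon → K
    G′ m n = G (revMon m) (revMon n)
    T T′ : List Word → Word → K
    T  Bs v = ⟪ Yprod v Bs ∣ (λ m → ⟪ Y i v ∣ G m ⟫) ⟫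
    T′ Bs v = ⟪ Yprod v Bs ∣ (λ m → ⟪ Y i v ∣ G′ m ⟫) ⟫
    T′≈T : ∀ Bs {v} → length v ≡ length Bs → T′ (reverseBlocks Bs) (reverse v) ≈ T Bs v
    T′≈T Bs {v} e = begin
      ⟪ Yprod (reverse v) (reverseBlocks Bs) ∣ (λ m → ⟪ Y i (reverse v) ∣ G′ m ⟫) ⟫
        ≈⟨ ⟪⟫-cong (Yprod (reverse v) (reverseBlocks Bs)) (λ m → ⟪⟫-Y-reverse i (reverse v) (G (revMon m))) ⟩
      ⟪ Yprod (reverse v) (reverseBlocks Bs) ∣ (λ m → ⟪ Y i (reverse (reverse v)) ∣ G (revMon m) ⟫) ⟫
        ≡⟨ ≡.cong (λ w → ⟪ Yprod (reverse v) (reverseBlocks Bs) ∣ (λ m → ⟪ Y i w ∣ G (revMon m) ⟫) ⟫) (List.reverse-involutive v) ⟩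
      ⟪ Yprod (reverse v) (reverseBlocks Bs) ∣ (λ m → ⟪ Y i v ∣ G (revMon m) ⟫) ⟫
        ≈⟨ ⟪⟫-Yprod-reverse (reverse v) (reverseBlocks Bs) (≡.trans (List.length-reverse v) (≡.trans e (≡.sym (length-reverseBlocks Bs)))) _ ⟩
      ⟪ Yprod (reverse (reverse v)) (reverseBlocks (reverseBlocks Bs)) ∣ (λ m → ⟪ Y i v ∣ G m ⟫) ⟫
        ≡⟨ ≡.cong₂ (λ w Cs → ⟪ Yprod w Cs ∣ (λ m → ⟪ Y i v ∣ G m ⟫) ⟫) (List.reverse-involutive v) (reverseBlocks-involutive Bs) ⟩
      T Bs v ∎

  ⟪⟫-ΔMon-++ : ∀ m n G → ⟪ ΔMon (m ++ n) ∣ G ⟫₂ ≈ ⟪ ΔMon m ∣ (λ p p′ → ⟪ ΔMon n ∣ (λ q q′ → G (p ++ q) (p′ ++ q′)) ⟫₂) ⟫₂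
  ⟪⟫-ΔMon-++ []      n G = sym (⟪⟫-oneT (λ p p′ → ⟪ ΔMon n ∣ (λ q q′ → G (p ++ q) (p′ ++ q′)) ⟫₂))
  ⟪⟫-ΔMon-++ (g ∷ m) n G = begin
    ⟪ Δgen g ·T ΔMon (m ++ n) ∣ G ⟫₂
      ≈⟨ ⟪⟫-·T (Δgen g) _ G ⟩
    ⟪ Δgen g ∣ (λ a a′ → ⟪ ΔMon (m ++ n) ∣ (λ b b′ → G (a ++ b) (a′ ++ b′)) ⟫₂) ⟫₂
      ≈⟨ ⟪⟫-cong (Δgen g) (λ _ → ⟪⟫-ΔMon-++ m n _) ⟩
    ⟪ Δgen g ∣ (λ a a′ → ⟪ ΔMon m ∣ (λ p p′ → ⟪ ΔMon n ∣ (λ q q′ → G (a ++ (p ++ q)) (a′ ++ (p′ ++ q′))) ⟫₂) ⟫₂) ⟫₂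
      ≈⟨ ⟪⟫-cong (Δgen g) (λ (a , a′) → ⟪⟫-cong (ΔMon m) (λ (p , p′) → ⟪⟫-cong (ΔMon n) (λ (q , q′) →
           reflexive (≡.cong₂ G (≡.sym (List.++-assoc a p q)) (≡.sym (List.++-assoc a′ p′ q′)))))) ⟩
    ⟪ Δgen g ∣ (λ a a′ → ⟪ ΔMon m ∣ (λ p p′ → ⟪ ΔMon n ∣ (λ q q′ → G ((a ++ p) ++ q) ((a′ ++ p′) ++ q′)) ⟫₂) ⟫₂) ⟫₂
      ≈⟨ ⟪⟫-·T (Δgen g) (ΔMon m) _ ⟨
    ⟪ Δgen g ·T ΔMon m ∣ (λ p p′ → ⟪ ΔMon n ∣ (λ q q′ → G (p ++ q) (p′ ++ q′)) ⟫₂) ⟫₂ ∎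

  ⟪⟫-ΔMon-[_] : ∀ g G → ⟪ ΔMon (g ∷ []) ∣ G ⟫₂ ≈ ⟪ Δgen g ∣ G ⟫₂
  ⟪⟫-ΔMon-[ g ] G = trans (⟪⟫-·T (Δgen g) oneT G) (⟪⟫-cong (Δgen g) (λ (p , p′) →
    trans (⟪⟫-oneT (λ q q′ → G (p ++ q) (p′ ++ q′))) (reflexive (≡.cong₂ G (List.++-identityʳ p) (List.++-identityʳ p′)))))

  ⟪⟫-ΔMon-revMon : ∀ m G → ⟪ ΔMon m ∣ G ⟫₂ ≈ ⟪ ΔMon (revMon m) ∣ (λ p q → G (revMon p) (revMon q)) ⟫₂
  ⟪⟫-ΔMon-revMon []      G = refl
  ⟪⟫-ΔMon-revMon (g ∷ m) G = begin
    ⟪ Δgen g ·T ΔMon m ∣ G ⟫₂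
      ≈⟨ ⟪⟫-·T (Δgen g) (ΔMon m) G ⟩
    ⟪ Δgen g ∣ (λ a a′ → ⟪ ΔMon m ∣ (λ b b′ → G (a ++ b) (a′ ++ b′)) ⟫₂) ⟫₂
      ≈⟨ ⟪⟫-cong (Δgen g) (λ _ → ⟪⟫-ΔMon-revMon m _) ⟩
    ⟪ Δgen g ∣ (λ a a′ → ⟪ ΔMon m′ ∣ (λ b b′ → G (a ++ revMon b) (a′ ++ revMon b′)) ⟫₂) ⟫₂
      ≈⟨ ⟪⟫-Δgen-revGen g _ ⟩
    ⟪ Δgen g′ ∣ (λ a a′ → ⟪ ΔMon m′ ∣ (λ b b′ → G (revMon a ++ revMon b) (revMon a′ ++ revMon b′)) ⟫₂) ⟫₂
      ≈⟨ ⟪⟫-swap (Δgen g′) (ΔMon m′) _ ⟩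
    ⟪ ΔMon m′ ∣ (λ b b′ → ⟪ Δgen g′ ∣ (λ a a′ → G (revMon a ++ revMon b) (revMon a′ ++ revMon b′)) ⟫₂) ⟫₂
      ≈⟨ ⟪⟫-cong (ΔMon m′) (λ (b , b′) → trans (⟪⟫-cong (Δgen g′) (λ (a , a′) →
           reflexive (≡.cong₂ G (≡.sym (revMon-++ b a)) (≡.sym (revMon-++ b′ a′))))) (sym (⟪⟫-ΔMon-[ g′ ] _))) ⟩
    ⟪ ΔMon m′ ∣ (λ b b′ → ⟪ ΔMon (g′ ∷ []) ∣ (λ a a′ → G (revMon (b ++ a)) (revMon (b′ ++ a′))) ⟫₂) ⟫₂
      ≈⟨ ⟪⟫-ΔMon-++ m′ (g′ ∷ []) _ ⟨
    ⟪ ΔMon (m′ ++ g′ ∷ []) ∣ (λ p q → G (revMon p) (revMon q)) ⟫₂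
      ≡⟨ ≡.cong (λ n → ⟪ ΔMon n ∣ (λ p q → G (revMon p) (revMon q)) ⟫₂) (revMon-++ (g ∷ []) m) ⟨
    ⟪ ΔMon (revMon (g ∷ m)) ∣ (λ p q → G (revMon p) (revMon q)) ⟫₂ ∎
    where
    m′ = revMon m
    g′ = revGen g

  Δ≈s⊗s∘Δ∘s : ∀ x → ΔH x ≈T s⊗s (ΔH (sH x))
  Δ≈s⊗s∘Δ∘s x = ≋⇒≈T {ΔH x} {s⊗s (ΔH (sH x))} (λ g → sym (pairing (λ p q → g (p , q))))
    where
    pairing : ∀ G → ⟪ s⊗s (ΔH (sH x)) ∣ G ⟫₂ ≈ ⟪ ΔH x ∣ G ⟫₂
    pairing G = begin
      ⟪ s⊗s (ΔH (sH x)) ∣ G ⟫₂                                               ≈⟨ ⟪⟫-s⊗s (ΔH (sH x)) G ⟩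
      ⟪ ΔH (sH x) ∣ (λ p q → G (revMon p) (revMon q)) ⟫₂                       ≈⟨ ⟪⟫-ΔH (sH x) _ ⟩
      ⟪ sH x ∣ (λ m → ⟪ ΔMon m ∣ (λ p q → G (revMon p) (revMon q)) ⟫₂) ⟫        ≈⟨ ⟪⟫-sH x _ ⟩
      ⟪ x ∣ (λ m → ⟪ ΔMon (revMon m) ∣ (λ p q → G (revMon p) (revMon q)) ⟫₂) ⟫ ≈⟨ ⟪⟫-cong x (λ m → ⟪⟫-ΔMon-revMon m G) ⟨
      ⟪ x ∣ (λ m → ⟪ ΔMon m ∣ G ⟫₂) ⟫                                          ≈⟨ ⟪⟫-ΔH x G ⟨
      ⟪ ΔH x ∣ G ⟫₂ ∎

  -- The counit

  εMon-++ : ∀ m n → εMon (m ++ n) ≈ εMon m * εMon n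
  εMon-++ []      n = sym (*-identityˡ _)
  εMon-++ (g ∷ m) n = sym (zeroˡ _)

  ⟪⟫-εMon-Y-[_] : ∀ j i → ⟪ Y i (j ∷ []) ∣ εMon ⟫ ≈ δ i j
  ⟪⟫-εMon-Y-[ j ] i with i Fin.≟ j
  ... | yes _ = trans (+-identityʳ _) (*-identityˡ 1#)
  ... | no  _ = refl

  ⟪⟫-εMon-Y-long : ∀ i v {q} → length v ≡ suc (suc q) → ⟪ Y i v ∣ εMon ⟫ ≈ 0#
  ⟪⟫-εMon-Y-long i (a ∷ b ∷ r) _ = trans (+-identityʳ _) (zeroʳ 1#)

  atOneBlock : List Word → (Word → K) → K
  atOneBlock []           H = 0#
  atOneBlock (B ∷ [])     H = H B
  atOneBlock (B ∷ C ∷ Cs) H = 0#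

  ∑-splits-atOneBlock : ∀ x xs H → ∑ (splits (x ∷ xs)) (λ Bs → atOneBlock Bs H) ≈ H (x ∷ xs)
  ∑-splits-atOneBlock x []       H = +-identityʳ _
  ∑-splits-atOneBlock x (y ∷ ys) H = begin
    ∑ (splits (x ∷ y ∷ ys)) (λ Bs → atOneBlock Bs H)
      ≈⟨ ∑-splits-∷ x (y ∷ ys) _ ⟩
    ∑ (splits (y ∷ ys)) (onCons x (λ Bs → atOneBlock Bs H))
      ≈⟨ ∑-cong-All (concat-splits (y ∷ ys)) (λ {Bs} → onCons-atOneBlock Bs) ⟩
    ∑ (splits (y ∷ ys)) (λ Bs → atOneBlock Bs (λ w → H (x ∷ w)))
      ≈⟨ ∑-splits-atOneBlock y ys (λ w → H (x ∷ w)) ⟩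
    H (x ∷ y ∷ ys) ∎
    where
    onCons-atOneBlock : ∀ Bs → concat Bs ≡ y ∷ ys → onCons x (λ Bs → atOneBlock Bs H) Bs ≈ atOneBlock Bs (λ w → H (x ∷ w))
    onCons-atOneBlock []           ()
    onCons-atOneBlock (B ∷ [])     _ = +-identityˡ _
    onCons-atOneBlock (B ∷ C ∷ Cs) _ = +-identityˡ _

  ∑-Yprod-εMon-Y : ∀ i Bs G → ∑ (wordsOfLength (length Bs)) (λ v → ⟪ Yprod v Bs ∣ G ⟫ * ⟪ Y i v ∣ εMon ⟫) ≈ atOneBlock Bs (λ B → ⟪ Y i B ∣ G ⟫)
  ∑-Yprod-εMon-Y i []           G = trans (+-identityʳ _) (zeroʳ _)
  ∑-Yprod-εMon-Y i (B ∷ [])     G = begin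
    ∑ (wordsOfLength 1) (λ v → ⟪ Yprod v (B ∷ []) ∣ G ⟫ * ⟪ Y i v ∣ εMon ⟫)  ≈⟨ ∑-wordsOfLength-∷ 0 _ ⟩
    ∑ (allFin N) (λ j → ⟪ Yprod (j ∷ []) (B ∷ []) ∣ G ⟫ * ⟪ Y i (j ∷ []) ∣ εMon ⟫ + 0#)
      ≈⟨ ∑-cong (allFin N) (λ j → trans (+-identityʳ _) (trans (*-cong (⟪⟫-prodH-[ Y j B ] G) (⟪⟫-εMon-Y-[ j ] i)) (*-comm _ _))) ⟩
    ∑ (allFin N) (λ j → δ i j * ⟪ Y j B ∣ G ⟫)                                ≈⟨ ∑-δ (Unique.allFin⁺ N) (∈-allFin i) (λ j → ⟪ Y j B ∣ G ⟫) ⟩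
    ⟪ Y i B ∣ G ⟫ ∎
  ∑-Yprod-εMon-Y i (B ∷ C ∷ Cs) G = trans
    (∑-cong-All (length-wordsOfLength (length (B ∷ C ∷ Cs))) (λ {v} ∣v∣ → trans (*-congˡ (⟪⟫-εMon-Y-long i v ∣v∣)) (zeroʳ _)))
    (∑-zero (wordsOfLength (length (B ∷ C ∷ Cs))) (λ _ → refl))

  ⟪⟫-Δgen-εʳ : ∀ g G → ⟪ Δgen g ∣ (λ p q → G p * εMon q) ⟫₂ ≈ G (g ∷ [])
  ⟪⟫-Δgen-εʳ (i , a , b , r) G = begin
    ⟪ Δgen (i , a , b , r) ∣ (λ p q → G p * εMon q) ⟫₂
      ≈⟨ ⟪⟫-Δgen i (a , b , r) _ ⟩
    ∑Δ u (λ Bs v → ⟪ Yprod v Bs ∣ (λ m → ⟪ Y i v ∣ (λ n → G m * εMon n) ⟫) ⟫)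
      ≈⟨ ∑-cong (splits u) (λ Bs → ∑-cong (wordsOfLength (length Bs)) (λ v →
           trans (⟪⟫-cong (Yprod v Bs) (λ m → ⟪⟫-* (Y i v) (G m) εMon)) (⟪⟫-*ʳ (Yprod v Bs) G _))) ⟩
    ∑Δ u (λ Bs v → ⟪ Yprod v Bs ∣ G ⟫ * ⟪ Y i v ∣ εMon ⟫)
      ≈⟨ ∑-cong (splits u) (λ Bs → ∑-Yprod-εMon-Y i Bs G) ⟩
    ∑ (splits u) (λ Bs → atOneBlock Bs (λ B → ⟪ Y i B ∣ G ⟫))
      ≈⟨ ∑-splits-atOneBlock a (b ∷ r) _ ⟩
    ⟪ Y i u ∣ G ⟫
      ≈⟨ ⟪⟫-basis _ G ⟩
    G ((i , a , b , r) ∷ []) ∎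
    where u = a ∷ b ∷ r

  ⟪⟫-ΔMon-εʳ : ∀ m G → ⟪ ΔMon m ∣ (λ p q → G p * εMon q) ⟫₂ ≈ G m
  ⟪⟫-ΔMon-εʳ []      G = trans (⟪⟫-oneT (λ p q → G p * εMon q)) (*-identityʳ _)
  ⟪⟫-ΔMon-εʳ (g ∷ m) G = begin
    ⟪ Δgen g ·T ΔMon m ∣ (λ p q → G p * εMon q) ⟫₂
      ≈⟨ ⟪⟫-·T (Δgen g) (ΔMon m) _ ⟩
    ⟪ Δgen g ∣ (λ a a′ → ⟪ ΔMon m ∣ (λ b b′ → G (a ++ b) * εMon (a′ ++ b′)) ⟫₂) ⟫₂
      ≈⟨ ⟪⟫-cong (Δgen g) (λ (a , a′) → begin
           ⟪ ΔMon m ∣ (λ b b′ → G (a ++ b) * εMon (a′ ++ b′)) ⟫₂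
             ≈⟨ ⟪⟫-cong (ΔMon m) (λ (b , b′) → trans (*-congˡ (trans (εMon-++ a′ b′) (*-comm _ _))) (sym (*-assoc _ _ _))) ⟩
           ⟪ ΔMon m ∣ (λ b b′ → (G (a ++ b) * εMon b′) * εMon a′) ⟫₂
             ≈⟨ ⟪⟫-*ʳ (ΔMon m) _ (εMon a′) ⟩
           ⟪ ΔMon m ∣ (λ b b′ → G (a ++ b) * εMon b′) ⟫₂ * εMon a′
             ≈⟨ *-congʳ (⟪⟫-ΔMon-εʳ m (λ b → G (a ++ b))) ⟩
           G (a ++ m) * εMon a′ ∎) ⟩
    ⟪ Δgen g ∣ (λ a a′ → G (a ++ m) * εMon a′) ⟫₂
      ≈⟨ ⟪⟫-Δgen-εʳ g (λ a → G (a ++ m)) ⟩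
    G (g ∷ m) ∎

  nonemptyʳ : (Mon → Mon → K) → Mon → Mon → K
  nonemptyʳ G p []      = 0#
  nonemptyʳ G p (g ∷ q) = G p (g ∷ q)

  ⟪⟫-ΔMon-split : ∀ m G → ⟪ ΔMon m ∣ G ⟫₂ ≈ G m [] + ⟪ ΔMon m ∣ nonemptyʳ G ⟫₂
  ⟪⟫-ΔMon-split m G = begin
    ⟪ ΔMon m ∣ G ⟫₂                                                      ≈⟨ ⟪⟫-cong (ΔMon m) (λ (p , q) → split p q) ⟩
    ⟪ ΔMon m ∣ (λ p q → G p [] * εMon q + nonemptyʳ G p q) ⟫₂             ≈⟨ ⟪⟫-+ (ΔMon m) _ _ ⟩
    ⟪ ΔMon m ∣ (λ p q → G p [] * εMon q) ⟫₂ + ⟪ ΔMon m ∣ nonemptyʳ G ⟫₂  ≈⟨ +-congʳ (⟪⟫-ΔMon-εʳ m (λ p → G p [])) ⟩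
    G m [] + ⟪ ΔMon m ∣ nonemptyʳ G ⟫₂ ∎
    where
    split : ∀ p q → G p q ≈ G p [] * εMon q + nonemptyʳ G p q
    split p []      = sym (trans (+-identityʳ _) (*-identityʳ _))
    split p (g ∷ q) = sym (trans (+-congʳ (zeroʳ _)) (+-identityˡ _))

  ⟪⟫-ΔMon²-split : ∀ m n (Φ : Mon → Mon → Mon → Mon → K) →
    ⟪ ΔMon m ∣ (λ p₁ q₁ → ⟪ ΔMon n ∣ Φ p₁ q₁ ⟫₂) ⟫₂ ≈
    Φ m [] n [] + (⟪ ΔMon m ∣ nonemptyʳ (λ p₁ q₁ → Φ p₁ q₁ n []) ⟫₂ +
                   ⟪ ΔMon m ∣ (λ p₁ q₁ → ⟪ ΔMon n ∣ nonemptyʳ (Φ p₁ q₁) ⟫₂) ⟫₂)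
  ⟪⟫-ΔMon²-split m n Φ = begin
    ⟪ ΔMon m ∣ (λ p₁ q₁ → ⟪ ΔMon n ∣ Φ p₁ q₁ ⟫₂) ⟫₂
      ≈⟨ ⟪⟫-cong (ΔMon m) (λ (p₁ , q₁) → ⟪⟫-ΔMon-split n (Φ p₁ q₁)) ⟩
    ⟪ ΔMon m ∣ (λ p₁ q₁ → Φ p₁ q₁ n [] + ⟪ ΔMon n ∣ nonemptyʳ (Φ p₁ q₁) ⟫₂) ⟫₂
      ≈⟨ ⟪⟫-+ (ΔMon m) _ _ ⟩
    ⟪ ΔMon m ∣ (λ p₁ q₁ → Φ p₁ q₁ n []) ⟫₂ + R₂
      ≈⟨ +-congʳ (⟪⟫-ΔMon-split m (λ p₁ q₁ → Φ p₁ q₁ n [])) ⟩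
    (Φ m [] n [] + R₁) + R₂
      ≈⟨ +-assoc _ _ _ ⟩
    Φ m [] n [] + (R₁ + R₂) ∎
    where
    R₁ R₂ : K
    R₁ = ⟪ ΔMon m ∣ nonemptyʳ (λ p₁ q₁ → Φ p₁ q₁ n []) ⟫₂
    R₂ = ⟪ ΔMon m ∣ (λ p₁ q₁ → ⟪ ΔMon n ∣ nonemptyʳ (Φ p₁ q₁) ⟫₂) ⟫₂


module Degree {c ℓ} (R : CommutativeRing c ℓ) (N : ℕ) where
  open HopfDefs R N
  open import Data.Nat using (_+_)
  open Linear R using (All-bilinear)
  open Combinatorics R N
  open import Algebra.Properties.CommutativeSemigroup ℕ.+-commutativeSemigroup renaming (interchange to ℕ-interchange)
  open ≡.≡-Reasoning

  degGen : Gen → ℕ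
  degGen (i , a , b , r) = suc (length r)

  deg : Mon → ℕ
  deg []      = 0
  deg (g ∷ m) = degGen g + deg m

  deg-++ : ∀ m n → deg (m ++ n) ≡ deg m + deg n
  deg-++ []      n = ≡.refl
  deg-++ (g ∷ m) n = ≡.trans (≡.cong (degGen g +_) (deg-++ m n)) (≡.sym (ℕ.+-assoc (degGen g) (deg m) (deg n)))

  HasDeg : ℕ → Mon × Mon → Set
  HasDeg d (p , q) = deg p + deg q ≡ d

  deg-< : ∀ {d} p g q → HasDeg d (p , g ∷ q) → deg p < d
  deg-< p g q e = ≡.subst (deg p <_) e (ℕ.m<m+n (deg p) (s≤s z≤n))

  deg-≤ : ∀ {d} p q → HasDeg d (p , q) → deg p ≤ d
  deg-≤ p q e = ≡.subst (deg p ≤_) e (ℕ.m≤m+n (deg p) (deg q))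

  Y-deg : ∀ j B → All (λ e → suc (deg (proj₂ e)) ≡ length B) (Y j B)
  Y-deg j []          = []
  Y-deg j (b ∷ [])    with j Fin.≟ b
  ... | yes _ = ≡.refl ∷ []
  ... | no  _ = []
  Y-deg j (a ∷ b ∷ r) = ≡.cong suc (ℕ.+-identityʳ (suc (length r))) ∷ []

  Yprod-deg : ∀ v Bs → length v ≡ length Bs → All (λ e → deg (proj₂ e) + length Bs ≡ length (concat Bs)) (Yprod v Bs)
  Yprod-deg []      []       _ = ≡.refl ∷ []
  Yprod-deg (j ∷ v) (B ∷ Bs) e =
    All-bilinear {P = λ p → suc (deg p) ≡ length B} {Q = λ q → deg q + length Bs ≡ length (concat Bs)}
                 _++_ (λ {p} {q} → add {p} {q}) (Y-deg j B) (Yprod-deg v Bs (ℕ.suc-injective e))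
    where
    add : ∀ {p q} → suc (deg p) ≡ length B → deg q + length Bs ≡ length (concat Bs) →
          deg (p ++ q) + suc (length Bs) ≡ length (concat (B ∷ Bs))
    add {p} {q} e₁ e₂ = begin
      deg (p ++ q) + suc (length Bs)    ≡⟨ ≡.cong (_+ suc (length Bs)) (deg-++ p q) ⟩
      deg p + deg q + suc (length Bs)   ≡⟨ ℕ.+-suc (deg p + deg q) (length Bs) ⟩
      suc (deg p + deg q + length Bs)   ≡⟨ ≡.cong suc (ℕ.+-assoc (deg p) (deg q) (length Bs)) ⟩
      suc (deg p) + (deg q + length Bs) ≡⟨ ≡.cong₂ _+_ e₁ e₂ ⟩
      length B + length (concat Bs)     ≡⟨ List.length-++ B ⟨
      length (concat (B ∷ Bs)) ∎

  Δgen-deg : ∀ g → All (λ e → HasDeg (deg (g ∷ [])) (proj₂ e)) (Δgen g)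
  Δgen-deg (i , a , b , r) = All-concatMap (All.map (λ {Bs} → partition-deg Bs) (concat-splits (a ∷ b ∷ r)))
    where
    term-deg : ∀ Bs v {p q} → concat Bs ≡ a ∷ b ∷ r → length v ≡ length Bs →
               deg p + length Bs ≡ length (concat Bs) → suc (deg q) ≡ length v → HasDeg (suc (length r) + 0) (p , q)
    term-deg Bs v {p} {q} concat≡ ∣v∣ e₁ e₂ = ≡.trans (ℕ.suc-injective (begin
      suc (deg p + deg q)  ≡⟨ ℕ.+-suc (deg p) (deg q) ⟨
      deg p + suc (deg q)  ≡⟨ ≡.cong (deg p +_) (≡.trans e₂ ∣v∣) ⟩
      deg p + length Bs    ≡⟨ e₁ ⟩
      length (concat Bs)   ≡⟨ ≡.cong length concat≡ ⟩
      suc (suc (length r)) ∎)) (≡.sym (ℕ.+-identityʳ _))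
    partition-deg : ∀ Bs → concat Bs ≡ a ∷ b ∷ r →
                    All (λ e → HasDeg (suc (length r) + 0) (proj₂ e)) (concatMap (λ v → Yprod v Bs ⊗ Y i v) (wordsOfLength (length Bs)))
    partition-deg Bs concat≡ = All-concatMap (All.map (λ {v} ∣v∣ →
      All-bilinear {P = λ p → deg p + length Bs ≡ length (concat Bs)} {Q = λ q → suc (deg q) ≡ length v}
                   _,_ (λ {p} {q} → term-deg Bs v {p} {q} concat≡ ∣v∣) (Yprod-deg v Bs ∣v∣) (Y-deg i v))
      (length-wordsOfLength (length Bs)))

  ΔMon-deg : ∀ m → All (λ e → HasDeg (deg m) (proj₂ e)) (ΔMon m)
  ΔMon-deg []      = ≡.refl ∷ []
  ΔMon-deg (g ∷ m) =
    All-bilinear {P = HasDeg (deg (g ∷ []))} {Q = HasDeg (deg m)}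
                 (λ (p , p′) (q , q′) → (p ++ q , p′ ++ q′)) (λ {pp′} {qq′} → add {pp′} {qq′}) (Δgen-deg g) (ΔMon-deg m)
    where
    add : ∀ {pp′ qq′} → HasDeg (deg (g ∷ [])) pp′ → HasDeg (deg m) qq′ →
          HasDeg (deg (g ∷ m)) (proj₁ pp′ ++ proj₁ qq′ , proj₂ pp′ ++ proj₂ qq′)
    add {p , p′} {q , q′} e₁ e₂ = begin
      deg (p ++ q) + deg (p′ ++ q′)       ≡⟨ ≡.cong₂ _+_ (deg-++ p q) (deg-++ p′ q′) ⟩
      (deg p + deg q) + (deg p′ + deg q′) ≡⟨ ℕ-interchange (deg p) (deg q) (deg p′) (deg q′) ⟩
      (deg p + deg p′) + (deg q + deg q′) ≡⟨ ≡.cong₂ _+_ (≡.trans e₁ (ℕ.+-identityʳ (degGen g))) e₂ ⟩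
      degGen g + deg m ∎

module Antipode {c ℓ} (R : CommutativeRing c ℓ) (N : ℕ)
                (S : HopfDefs.Mon R N → HopfDefs.H R N) (S-antipode : HopfDefs.IsAntipode R N S) where
  open HopfDefs R N
  open CommutativeRing R renaming (Carrier to K) hiding (zero)
  open import Algebra.Properties.Ring ring using (+-cancelʳ)
  open import Data.Nat using () renaming (_+_ to _+ℕ_)
  open import Data.Nat.Induction using (<-wellFounded)
  open import Induction.WellFounded using (Acc; acc)
  open Linear R
  open Combinatorics R N
  open Incidence R N
  open Degree R N
  open import Relation.Binary.Reasoning.Setoid setoid

  ⟪⟫-antipode : (f : Mon → Mon → H⊗H) → (∀ x → mH (extT→T f (ΔH x)) ≈H scale (εH x) oneH) →
                ∀ m h → ⟪ ΔMon m ∣ (λ p q → ⟪ f p q ∣ (λ a b → h (a ++ b)) ⟫₂) ⟫₂ ≈ εMon m * h []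
  ⟪⟫-antipode f antipode m h = begin
    ⟪ ΔMon m ∣ F ⟫₂
      ≈⟨ ⟪⟫-basis m (λ m′ → ⟪ ΔMon m′ ∣ F ⟫₂) ⟨
    ⟪ basis m ∣ (λ m′ → ⟪ ΔMon m′ ∣ F ⟫₂) ⟫
      ≈⟨ ⟪⟫-ΔH (basis m) F ⟨
    ⟪ ΔH (basis m) ∣ F ⟫₂
      ≈⟨ ⟪⟫-extT→T f (ΔH (basis m)) _ ⟨
    ⟪ extT→T f (ΔH (basis m)) ∣ (λ a b → h (a ++ b)) ⟫₂
      ≈⟨ ⟪⟫-mH (extT→T f (ΔH (basis m))) h ⟨
    ⟪ mH (extT→T f (ΔH (basis m))) ∣ h ⟫
      ≈⟨ ≈H⇒≋ {mH (extT→T f (ΔH (basis m)))} {scale (εH (basis m)) oneH} (antipode (basis m)) h ⟩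
    ⟪ scale (εH (basis m)) oneH ∣ h ⟫
      ≈⟨ ⟪⟫-scale _ oneH h ⟩
    εH (basis m) * ⟪ oneH ∣ h ⟫
      ≈⟨ *-cong (trans (εH≈⟪⟫ (basis m)) (⟪⟫-basis m εMon)) (⟪⟫-basis [] h) ⟩
    εMon m * h [] ∎
    where
    F : Mon → Mon → K
    F p q = ⟪ f p q ∣ (λ a b → h (a ++ b)) ⟫₂

  ⟪⟫-S-left : ∀ m h → ⟪ ΔMon m ∣ (λ p q → ⟪ S p ∣ (λ r → h (r ++ q)) ⟫) ⟫₂ ≈ εMon m * h []
  ⟪⟫-S-left m h = trans (⟪⟫-cong (ΔMon m) (λ (p , q) → sym (trans (⟪⟫-⊗ (S p) (basis q) _)
                          (⟪⟫-cong (S p) (λ a → ⟪⟫-basis q (λ b → h (a ++ b)))))))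
                        (⟪⟫-antipode _ (proj₁ S-antipode) m h)

  ⟪⟫-S-right : ∀ m h → ⟪ ΔMon m ∣ (λ p q → ⟪ S q ∣ (λ r → h (p ++ r)) ⟫) ⟫₂ ≈ εMon m * h []
  ⟪⟫-S-right m h = trans (⟪⟫-cong (ΔMon m) (λ (p , q) → sym (trans (⟪⟫-⊗ (basis p) (S q) _)
                           (⟪⟫-basis p (λ a → ⟪ S q ∣ (λ b → h (a ++ b)) ⟫)))))
                         (⟪⟫-antipode _ (proj₂ S-antipode) m h)

  ⟪⟫-S-[] : ∀ h → ⟪ S [] ∣ h ⟫ ≈ h []
  ⟪⟫-S-[] h = begin
    ⟪ S [] ∣ h ⟫
      ≈⟨ ⟪⟫-cong (S []) (λ r → reflexive (≡.cong h (≡.sym (List.++-identityʳ r)))) ⟩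
    ⟪ S [] ∣ (λ r → h (r ++ [])) ⟫
      ≈⟨ ⟪⟫-oneT (λ p q → ⟪ S p ∣ (λ r → h (r ++ q)) ⟫) ⟨
    ⟪ ΔMon [] ∣ (λ p q → ⟪ S p ∣ (λ r → h (r ++ q)) ⟫) ⟫₂
      ≈⟨ ⟪⟫-S-left [] h ⟩
    1# * h []
      ≈⟨ *-identityˡ _ ⟩
    h [] ∎

  ⟪⟫-S-++-acc : ∀ m n → Acc _<_ (deg m +ℕ deg n) → ∀ h →
                ⟪ S (m ++ n) ∣ h ⟫ ≈ ⟪ S n ∣ (λ a → ⟪ S m ∣ (λ b → h (a ++ b)) ⟫) ⟫
  ⟪⟫-S-++-acc [] n _ h = ⟪⟫-cong (S n) (λ a → sym (trans (⟪⟫-S-[] (λ b → h (a ++ b))) (reflexive (≡.cong h (List.++-identityʳ a)))))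
  ⟪⟫-S-++-acc m@(_ ∷ _) [] _ h = trans (reflexive (≡.cong (λ w → ⟪ S w ∣ h ⟫) (List.++-identityʳ m)))
                                       (sym (⟪⟫-S-[] (λ a → ⟪ S m ∣ (λ b → h (a ++ b)) ⟫)))
  -- Both Φ₁ and Φ₂ sum to 0 over Δm ⊗ Δn, and all their terms except the one at (m, [], n, [])
  -- agree by induction, because q₁ or q₂ nonempty forces deg p₁ + deg p₂ < deg m + deg n.
  ⟪⟫-S-++-acc m@(_ ∷ _) n@(_ ∷ _) (acc rs) h = begin
    ⟪ S (m ++ n) ∣ h ⟫
      ≈⟨ ⟪⟫-cong (S (m ++ n)) (λ r → reflexive (≡.cong h (List.++-identityʳ r))) ⟨
    Φ₁ m [] n []
      ≈⟨ +-cancelʳ (Rest Φ₂) _ _ (begin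
           Φ₁ m [] n [] + Rest Φ₂ ≈⟨ +-congˡ Rest-agree ⟨
           Φ₁ m [] n [] + Rest Φ₁ ≈⟨ ⟪⟫-ΔMon²-split m n Φ₁ ⟨
           D Φ₁                   ≈⟨ trans D-Φ₁≈0 (sym D-Φ₂≈0) ⟩
           D Φ₂                   ≈⟨ ⟪⟫-ΔMon²-split m n Φ₂ ⟩
           Φ₂ m [] n [] + Rest Φ₂ ∎) ⟩
    Φ₂ m [] n []
      ≈⟨ ⟪⟫-cong (S n) (λ a → ⟪⟫-cong (S m) (λ b → reflexive (≡.cong h (List.++-identityʳ (a ++ b))))) ⟩
    ⟪ S n ∣ (λ a → ⟪ S m ∣ (λ b → h (a ++ b)) ⟫) ⟫ ∎
    where
    Φ₁ Φ₂ : Mon → Mon → Mon → Mon → K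
    Φ₁ p₁ q₁ p₂ q₂ = ⟪ S (p₁ ++ p₂) ∣ (λ r → h (r ++ (q₁ ++ q₂))) ⟫
    Φ₂ p₁ q₁ p₂ q₂ = ⟪ S p₂ ∣ (λ a → ⟪ S p₁ ∣ (λ b → h ((a ++ b) ++ (q₁ ++ q₂))) ⟫) ⟫
    D : (Mon → Mon → Mon → Mon → K) → K
    D Φ = ⟪ ΔMon m ∣ (λ p₁ q₁ → ⟪ ΔMon n ∣ Φ p₁ q₁ ⟫₂) ⟫₂
    Rest : (Mon → Mon → Mon → Mon → K) → K
    Rest Φ = ⟪ ΔMon m ∣ nonemptyʳ (λ p₁ q₁ → Φ p₁ q₁ n []) ⟫₂ +
             ⟪ ΔMon m ∣ (λ p₁ q₁ → ⟪ ΔMon n ∣ nonemptyʳ (Φ p₁ q₁) ⟫₂) ⟫₂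

    D-Φ₁≈0 : D Φ₁ ≈ 0#
    D-Φ₁≈0 = trans (sym (⟪⟫-ΔMon-++ m n (λ p q → ⟪ S p ∣ (λ r → h (r ++ q)) ⟫))) (trans (⟪⟫-S-left (m ++ n) h) (zeroˡ _))

    D-Φ₂≈0 : D Φ₂ ≈ 0#
    D-Φ₂≈0 = trans (⟪⟫-swap (ΔMon m) (ΔMon n) _) (⟪⟫-zero (ΔMon n) (λ (p₂ , q₂) →
      trans (⟪⟫-swap (ΔMon m) (S p₂) _) (⟪⟫-zero (S p₂) (λ a → begin
        ⟪ ΔMon m ∣ (λ p₁ q₁ → ⟪ S p₁ ∣ (λ b → h ((a ++ b) ++ (q₁ ++ q₂))) ⟫) ⟫₂
          ≈⟨ ⟪⟫-cong (ΔMon m) (λ (p₁ , q₁) → ⟪⟫-cong (S p₁) (λ b → reflexive (≡.cong h (reassoc a b q₁ q₂)))) ⟩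
        ⟪ ΔMon m ∣ (λ p₁ q₁ → ⟪ S p₁ ∣ (λ b → h (a ++ ((b ++ q₁) ++ q₂))) ⟫) ⟫₂
          ≈⟨ ⟪⟫-S-left m (λ w → h (a ++ (w ++ q₂))) ⟩
        0# * h (a ++ ([] ++ q₂))
          ≈⟨ zeroˡ _ ⟩
        0# ∎))))
      where
      reassoc : ∀ a b q₁ q₂ → (a ++ b) ++ (q₁ ++ q₂) ≡ a ++ ((b ++ q₁) ++ q₂)
      reassoc a b q₁ q₂ = ≡.trans (List.++-assoc a b (q₁ ++ q₂)) (≡.cong (a ++_) (≡.sym (List.++-assoc b q₁ q₂)))

    IH : ∀ p₁ p₂ → deg p₁ +ℕ deg p₂ < deg m +ℕ deg n → ∀ q₁ q₂ → Φ₁ p₁ q₁ p₂ q₂ ≈ Φ₂ p₁ q₁ p₂ q₂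
    IH p₁ p₂ lt q₁ q₂ = ⟪⟫-S-++-acc p₁ p₂ (rs lt) (λ r → h (r ++ (q₁ ++ q₂)))

    Rest-agree : Rest Φ₁ ≈ Rest Φ₂
    Rest-agree = +-cong
      (⟪⟫-cong-All (ΔMon-deg m) (λ {(p₁ , q₁)} e₁ → outer p₁ q₁ e₁))
      (⟪⟫-cong-All (ΔMon-deg m) (λ {(p₁ , q₁)} e₁ → ⟪⟫-cong-All (ΔMon-deg n) (λ {(p₂ , q₂)} e₂ → inner p₁ q₁ p₂ q₂ e₁ e₂)))
      where
      outer : ∀ p₁ q₁ → HasDeg (deg m) (p₁ , q₁) → nonemptyʳ (λ p q → Φ₁ p q n []) p₁ q₁ ≈ nonemptyʳ (λ p q → Φ₂ p q n []) p₁ q₁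
      outer p₁ []      _  = refl
      outer p₁ (x ∷ q) e₁ = IH p₁ n (ℕ.+-monoˡ-< (deg n) (deg-< p₁ x q e₁)) (x ∷ q) []
      inner : ∀ p₁ q₁ p₂ q₂ → HasDeg (deg m) (p₁ , q₁) → HasDeg (deg n) (p₂ , q₂) →
              nonemptyʳ (Φ₁ p₁ q₁) p₂ q₂ ≈ nonemptyʳ (Φ₂ p₁ q₁) p₂ q₂
      inner p₁ q₁ p₂ []      _  _  = refl
      inner p₁ q₁ p₂ (x ∷ q) e₁ e₂ = IH p₁ p₂ (ℕ.+-mono-≤-< (deg-≤ p₁ q₁ e₁) (deg-< p₂ x q e₂)) q₁ (x ∷ q)

  ⟪⟫-S-++ : ∀ m n h → ⟪ S (m ++ n) ∣ h ⟫ ≈ ⟪ S n ∣ (λ a → ⟪ S m ∣ (λ b → h (a ++ b)) ⟫) ⟫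
  ⟪⟫-S-++ m n = ⟪⟫-S-++-acc m n (<-wellFounded (deg m +ℕ deg n))

  T : Mon → H
  T m = sH (S (revMon m))

  ⟪⟫-s∘S∘s : ∀ x k → ⟪ sH (ext S (sH x)) ∣ k ⟫ ≈ ⟪ x ∣ (λ m → ⟪ T m ∣ k ⟫) ⟫
  ⟪⟫-s∘S∘s x k = begin
    ⟪ sH (ext S (sH x)) ∣ k ⟫                                   ≈⟨ ⟪⟫-sH (ext S (sH x)) k ⟩
    ⟪ ext S (sH x) ∣ (λ r → k (revMon r)) ⟫                     ≈⟨ ⟪⟫-ext S (sH x) _ ⟩
    ⟪ sH x ∣ (λ m → ⟪ S m ∣ (λ r → k (revMon r)) ⟫) ⟫           ≈⟨ ⟪⟫-sH x _ ⟩
    ⟪ x ∣ (λ m → ⟪ S (revMon m) ∣ (λ r → k (revMon r)) ⟫) ⟫     ≈⟨ ⟪⟫-cong x (λ m → ⟪⟫-sH (S (revMon m)) k) ⟨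
    ⟪ x ∣ (λ m → ⟪ T m ∣ k ⟫) ⟫ ∎

  εMon-revMon : ∀ m → εMon (revMon m) ≡ εMon m
  εMon-revMon []      = ≡.refl
  εMon-revMon (g ∷ m) = ≡.trans (≡.cong εMon (revMon-++ (g ∷ []) m)) (εMon-∷ʳ (revMon m))
    where
    εMon-∷ʳ : ∀ l → εMon (l ++ revGen g ∷ []) ≡ 0#
    εMon-∷ʳ []      = ≡.refl
    εMon-∷ʳ (_ ∷ _) = ≡.refl

  ⟪⟫-T-left : ∀ m h → ⟪ ΔMon m ∣ (λ p q → ⟪ T p ∣ (λ r → h (q ++ r)) ⟫) ⟫₂ ≈ εMon m * h []
  ⟪⟫-T-left m h = begin
    ⟪ ΔMon m ∣ (λ p q → ⟪ T p ∣ (λ r → h (q ++ r)) ⟫) ⟫₂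
      ≈⟨ ⟪⟫-ΔMon-revMon m _ ⟩
    ⟪ ΔMon (revMon m) ∣ (λ p q → ⟪ T (revMon p) ∣ (λ r → h (revMon q ++ r)) ⟫) ⟫₂
      ≈⟨ ⟪⟫-cong (ΔMon (revMon m)) (λ (p , q) → begin
           ⟪ T (revMon p) ∣ (λ r → h (revMon q ++ r)) ⟫
             ≈⟨ ⟪⟫-sH (S (revMon (revMon p))) _ ⟩
           ⟪ S (revMon (revMon p)) ∣ (λ r → h (revMon q ++ revMon r)) ⟫
             ≡⟨ ≡.cong (λ p′ → ⟪ S p′ ∣ (λ r → h (revMon q ++ revMon r)) ⟫) (revMon-involutive p) ⟩
           ⟪ S p ∣ (λ r → h (revMon q ++ revMon r)) ⟫
             ≈⟨ ⟪⟫-cong (S p) (λ r → reflexive (≡.cong h (≡.sym (revMon-++ r q)))) ⟩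
           ⟪ S p ∣ (λ r → h (revMon (r ++ q))) ⟫ ∎) ⟩
    ⟪ ΔMon (revMon m) ∣ (λ p q → ⟪ S p ∣ (λ r → h (revMon (r ++ q))) ⟫) ⟫₂
      ≈⟨ ⟪⟫-S-left (revMon m) (λ w → h (revMon w)) ⟩
    εMon (revMon m) * h []
      ≡⟨ ≡.cong (_* h []) (εMon-revMon m) ⟩
    εMon m * h [] ∎

  ⟪⟫-S∘T-acc : ∀ m → Acc _<_ (deg m) → ∀ h → ⟪ T m ∣ (λ r → ⟪ S r ∣ h ⟫) ⟫ ≈ h m
  ⟪⟫-S∘T-acc [] _ h = begin
    ⟪ T [] ∣ (λ r → ⟪ S r ∣ h ⟫) ⟫            ≈⟨ ⟪⟫-sH (S []) _ ⟩
    ⟪ S [] ∣ (λ r → ⟪ S (revMon r) ∣ h ⟫) ⟫   ≈⟨ ⟪⟫-S-[] _ ⟩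
    ⟪ S [] ∣ h ⟫                              ≈⟨ ⟪⟫-S-[] h ⟩
    h [] ∎
  -- F sums to Σ S(m₂ T(m₁)) = 0 and F₂ to Σ m₁ S(m₂) = 0; since S(q T(p)) = S(T(p)) S(q),
  -- all terms with q ≠ [] agree by induction on deg p.
  ⟪⟫-S∘T-acc m@(_ ∷ _) (acc rs) h = begin
    F m []                 ≈⟨ +-cancelʳ (Rest F₂) _ _ (begin
      F m [] + Rest F₂       ≈⟨ +-congˡ Rest-agree ⟨
      F m [] + Rest F        ≈⟨ ⟪⟫-ΔMon-split m F ⟨
      ⟪ ΔMon m ∣ F ⟫₂        ≈⟨ trans (⟪⟫-T-left m (λ w → ⟪ S w ∣ h ⟫)) (zeroˡ _) ⟩
      0#                     ≈⟨ trans (⟪⟫-S-right m h) (zeroˡ _) ⟨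
      ⟪ ΔMon m ∣ F₂ ⟫₂       ≈⟨ ⟪⟫-ΔMon-split m F₂ ⟩
      F₂ m [] + Rest F₂ ∎) ⟩
    F₂ m []                ≈⟨ ⟪⟫-S-[] (λ r → h (m ++ r)) ⟩
    h (m ++ [])            ≡⟨ ≡.cong h (List.++-identityʳ m) ⟩
    h m ∎
    where
    F F₂ : Mon → Mon → K
    F  p q = ⟪ T p ∣ (λ r → ⟪ S (q ++ r) ∣ h ⟫) ⟫
    F₂ p q = ⟪ S q ∣ (λ r → h (p ++ r)) ⟫
    Rest : (Mon → Mon → K) → K
    Rest G = ⟪ ΔMon m ∣ nonemptyʳ G ⟫₂
    Rest-agree : Rest F ≈ Rest F₂
    Rest-agree = ⟪⟫-cong-All (ΔMon-deg m) (λ {(p , q)} e → agree p q e)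
      where
      agree : ∀ p q → HasDeg (deg m) (p , q) → nonemptyʳ F p q ≈ nonemptyʳ F₂ p q
      agree p []      _ = refl
      agree p (x ∷ q) e = begin
        ⟪ T p ∣ (λ r → ⟪ S ((x ∷ q) ++ r) ∣ h ⟫) ⟫
          ≈⟨ ⟪⟫-cong (T p) (λ r → ⟪⟫-S-++ (x ∷ q) r h) ⟩
        ⟪ T p ∣ (λ r → ⟪ S r ∣ (λ a → ⟪ S (x ∷ q) ∣ (λ b → h (a ++ b)) ⟫) ⟫) ⟫
          ≈⟨ ⟪⟫-S∘T-acc p (rs (deg-< p x q e)) _ ⟩
        ⟪ S (x ∷ q) ∣ (λ b → h (p ++ b)) ⟫ ∎

  ⟪⟫-S∘T : ∀ m h → ⟪ T m ∣ (λ r → ⟪ S r ∣ h ⟫) ⟫ ≈ h m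
  ⟪⟫-S∘T m = ⟪⟫-S∘T-acc m (<-wellFounded (deg m))

  ⟪⟫-T∘S : ∀ m h → ⟪ S m ∣ (λ r → ⟪ T r ∣ h ⟫) ⟫ ≈ h m
  ⟪⟫-T∘S m h = begin
    ⟪ S m ∣ (λ r → ⟪ T r ∣ h ⟫) ⟫
      ≈⟨ ⟪⟫-cong (S m) (λ r → ⟪⟫-sH (S (revMon r)) h) ⟩
    ⟪ S m ∣ (λ r → ⟪ S (revMon r) ∣ (λ w → h (revMon w)) ⟫) ⟫
      ≡⟨ ≡.cong (λ m′ → ⟪ S m′ ∣ (λ r → ⟪ S (revMon r) ∣ (λ w → h (revMon w)) ⟫) ⟫) (revMon-involutive m) ⟨
    ⟪ S (revMon (revMon m)) ∣ (λ r → ⟪ S (revMon r) ∣ (λ w → h (revMon w)) ⟫) ⟫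
      ≈⟨ ⟪⟫-sH (S (revMon (revMon m))) _ ⟨
    ⟪ T (revMon m) ∣ (λ r → ⟪ S r ∣ (λ w → h (revMon w)) ⟫) ⟫
      ≈⟨ ⟪⟫-S∘T (revMon m) (λ w → h (revMon w)) ⟩
    h (revMon (revMon m))
      ≡⟨ ≡.cong h (revMon-involutive m) ⟩
    h m ∎

  S∘s∘S∘s≈id : ∀ x → ext S (sH (ext S (sH x))) ≈H x
  S∘s∘S∘s≈id x = ≋⇒≈H {ext S (sH (ext S (sH x)))} {x} λ h → begin
    ⟪ ext S (sH (ext S (sH x))) ∣ h ⟫                  ≈⟨ ⟪⟫-ext S (sH (ext S (sH x))) h ⟩
    ⟪ sH (ext S (sH x)) ∣ (λ r → ⟪ S r ∣ h ⟫) ⟫        ≈⟨ ⟪⟫-s∘S∘s x _ ⟩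
    ⟪ x ∣ (λ m → ⟪ T m ∣ (λ r → ⟪ S r ∣ h ⟫) ⟫) ⟫      ≈⟨ ⟪⟫-cong x (λ m → ⟪⟫-S∘T m h) ⟩
    ⟪ x ∣ h ⟫ ∎

  s∘S∘s∘S≈id : ∀ x → sH (ext S (sH (ext S x))) ≈H x
  s∘S∘s∘S≈id x = ≋⇒≈H {sH (ext S (sH (ext S x)))} {x} λ h → begin
    ⟪ sH (ext S (sH (ext S x))) ∣ h ⟫                  ≈⟨ ⟪⟫-s∘S∘s (ext S x) h ⟩
    ⟪ ext S x ∣ (λ m → ⟪ T m ∣ h ⟫) ⟫                  ≈⟨ ⟪⟫-ext S x _ ⟩
    ⟪ x ∣ (λ m → ⟪ S m ∣ (λ r → ⟪ T r ∣ h ⟫) ⟫) ⟫      ≈⟨ ⟪⟫-cong x (λ m → ⟪⟫-T∘S m h) ⟩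
    ⟪ x ∣ h ⟫ ∎

lemma5 : ∀ {c ℓ} (R : CommutativeRing c ℓ) (N : ℕ) → 1 ≤ N →
    let open HopfDefs R N in
    (S : Mon → H) → IsAntipode S →
      (∀ t → mop t ≈H sH (mH (s⊗s t))) ×
      (∀ x → ΔH x ≈T s⊗s (ΔH (sH x))) ×
      ((∀ x → ext S (sH (ext S (sH x))) ≈H x) × (∀ x → sH (ext S (sH (ext S x))) ≈H x))
lemma5 R N _ S S-antipode =
  mop≈s∘mH∘s⊗s , Δ≈s⊗s∘Δ∘s , S∘s∘S∘s≈id , s∘S∘s∘S≈id
  where
  open Incidence R N
  open Antipode R N S S-antipode
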